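{- Let $X\subseteq\mathbb{N}$, let $\rho=(\rho_1,\dots,\rho_m)$ be a composition of $n$, and let $s\ge0$. Write $[m]\setminus X=\{v_1,\dots,v_b\}$ and $a=\sum_{i=1}^b\rho_{v_i}$. Then $$P_{\rho,s}^{X}=\binom{a}{\rho_{v_1},\dots,\rho_{v_b}}\sum_{r=0}^{n-a-s}(-1)^{n-a-s-r}\binom{a+r}{r}\binom{n+1}{n-a-s-r}\prod_{x\in X\cap[m]}\binom{r+\beta_{X,\rho,x}}{\rho_x}.$$
   Context: A composition $\rho=(\rho_1,\dots,\rho_m)$ of $n$ has positive integer parts summing to $n$. $R(\rho)$ is the set of rearrangements of the word $1^{\rho_1}\cdots m^{\rho_m}$. For $X\subseteq\mathbb{N}$, $P_{\rho,s}^{X}$ is the number of $w\in R(\rho)$ with exactly $s$ indices $i$ such that $w_i>w_{i+1}$ and $w_i\in X$. For $x\in[m]$, $\beta_{X,\rho,x}=\sum_{z\notin X,\ 1\le z<x}\rho_z$. An empty sum is $0$. -}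

module Defs where

open import Data.Bool using (Bool; true; false; if_then_else_; _∧_; not)
open import Data.Nat using (ℕ; zero; suc; _+_; _*_; _∸_; _<ᵇ_; _≡ᵇ_; _≤_)
open import Data.Nat.Combinatorics using (_C_)
open import Data.List using (List; []; _∷_; map; length; concatMap; filter; upTo; foldr)
open import Data.Nat.ListAction using (sum; product)
open import Data.List.Relation.Unary.All using (All)
open import Data.Integer using (ℤ; +_; -_)
import Data.Integer as ℤ
open import Relation.Binary.PropositionalEquality using (_≡_)
open import Relation.Nullary.Decidable using (T?)

-- A composition ρ = (ρ₁,…,ρₘ) is a list of naturals; m = length ρ.
-- ρ_x for x ∈ [m] (1-based); 0 outside [m].
part : List ℕ → ℕ → ℕ
part []       _             = 0
part (k ∷ ks) zero          = 0
part (k ∷ ks) (suc zero)    = k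
part (k ∷ ks) (suc (suc x)) = part ks (suc x)

AllPos : List ℕ → Set
AllPos ρ = All (λ k → 1 ≤ k) ρ

range1 : ℕ → List ℕ
range1 m = map suc (upTo m)

words : ℕ → ℕ → List (List ℕ)
words m zero    = [] ∷ []
words m (suc n) = concatMap (λ c → map (c ∷_) (words m n)) (range1 m)

count : ℕ → List ℕ → ℕ
count x []       = 0
count x (y ∷ ys) = (if x ≡ᵇ y then 1 else 0) + count x ys

isRearr : List ℕ → List ℕ → Bool
isRearr ρ w = foldr _∧_ true (map (λ x → count x w ≡ᵇ part ρ x) (range1 (length ρ)))

R : List ℕ → List (List ℕ)
R ρ = filter (λ w → T? (isRearr ρ w)) (words (length ρ) (sum ρ))

desX : (ℕ → Bool) → List ℕ → ℕ
desX X []           = 0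
desX X (x ∷ [])     = 0
desX X (x ∷ y ∷ ys) = (if (y <ᵇ x) ∧ X x then 1 else 0) + desX X (y ∷ ys)

P : (ℕ → Bool) → List ℕ → ℕ → ℕ
P X ρ s = length (filter (λ w → T? (desX X w ≡ᵇ s)) (R ρ))

β : (ℕ → Bool) → List ℕ → ℕ → ℕ
β X ρ x = sum (map (λ z → if X z then 0 else part ρ z) (range1 (x ∸ 1)))

compl : (ℕ → Bool) → List ℕ → List ℕ
compl X ρ = filter (λ z → T? (not (X z))) (range1 (length ρ))

inter : (ℕ → Bool) → List ℕ → List ℕ
inter X ρ = filter (λ z → T? (X z)) (range1 (length ρ))

multinomial : List ℕ → ℕ
multinomial []       = 1
multinomial (k ∷ ks) = ((k + sum ks) C k) * multinomial ks

sgn : ℕ → ℤ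
sgn zero    = + 1
sgn (suc k) = - sgn k

Σ≤ : ℕ → (ℕ → ℤ) → ℤ
Σ≤ N f = foldr ℤ._+_ (+ 0) (map f (upTo (suc N)))

-- right-hand side of Corollary 5.7 (with n = Σρ); the sum is empty when a + s > n
RHS : (ℕ → Bool) → List ℕ → ℕ → ℕ → ℤ
RHS X ρ n s =
  let vs = compl X ρ
      a  = sum (map (part ρ) vs)
      N  = n ∸ (a + s)
      body = λ r → sgn (N ∸ r)
                   ℤ.* (+ ((a + r) C r))
                   ℤ.* (+ ((n + 1) C (N ∸ r)))
                   ℤ.* (+ product (map (λ x → (r + β X ρ x) C part ρ x) (inter X ρ)))
  in if n <ᵇ (a + s) then + 0
     else (+ multinomial (map (part ρ) vs)) ℤ.* Σ≤ N body

-- For t ∈ ℕ put weight t w = C(t + des_X w, n). Its sum over R(ρ) has the closed form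
-- M · C(t, a) · ∏_{x ∈ X ∩ [m]} C(t ∸ a + β_x, ρ_x), by induction on m: the rearrangements of
-- (ρ₁, …, ρₘ, k) are the insertions of k copies of the new largest letter ℓ = m + 1 into
-- rearrangements of ρ, and by Pascal's rule summing weight t over these insertions multiplies it by
-- C(t, k) if ℓ ∈ X, while if ℓ ∉ X it also replaces t by t ∸ k. Thus Σ_s P_s · C(t + s, n) is known
-- for every t, and the (n+1)-st finite difference in t isolates P_s as the alternating sum.

module Submission where

open import Data.Bool using (Bool; true; false; if_then_else_; _∧_; not; T)
open import Data.Bool.Properties using (∧-zeroʳ)
open import Data.Bool.ListAction using (and)
open import Data.Empty using (⊥-elim)
open import Data.Nat using (ℕ; zero; suc; _+_; _*_; _∸_; _<ᵇ_; _≡ᵇ_; _≤_; _<_; z≤n; s≤s; _!; NonZero)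
open import Data.Nat.Properties
open import Data.Nat.Combinatorics using (_C_; nCk+nC[k+1]≡[n+1]C[k+1])
open import Data.Nat.ListAction using (sum; product)
open import Data.Nat.ListAction.Properties using (sum-++; product-++)
open import Data.Nat.Tactic.RingSolver using (solve-∀)
open import Data.List using (List; []; _∷_; _++_; _∷ʳ_; map; length; filter; concat; foldr; replicate; upTo; applyUpTo)
open import Data.List.Properties using (map-++; map-cong; map-cong-local; map-∘; map-applyUpTo; applyUpTo-∷ʳ; ++-identityʳ; length-++; filter-++)
open import Data.List.Reverse using (Reverse; []; _∶_∶ʳ_; reverseView)
open import Data.List.Relation.Unary.All using (All; []; _∷_)
import Data.List.Relation.Unary.All as All
import Data.List.Relation.Unary.All.Properties as All
open import Data.List.Relation.Unary.Any using (here; there)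
open import Data.List.Membership.Propositional using (_∈_)
open import Data.List.Membership.Propositional.Properties using (∈-applyUpTo⁺)
import Data.Integer as ℤ
import Data.Integer.Properties as ℤ
import Data.Integer.Tactic.RingSolver as ℤ-Solver
open import Data.Product using (_×_; _,_)
open import Function using (_∘_; id)
open import Relation.Binary.PropositionalEquality
open import Relation.Binary.Definitions using (tri<; tri≈; tri>)
open import Relation.Nullary using (yes; no)
open import Relation.Nullary.Decidable using (T?)

open import Defs

-- Pascal's rule, which unlike the library's _C_ computes by recursion (see binomial≡C).
binomial : ℕ → ℕ → ℕ
binomial zero    zero    = 1
binomial zero    (suc k) = 0
binomial (suc n) zero    = 1
binomial (suc n) (suc k) = binomial n k + binomial n (suc k)

binomial≡C : ∀ n k → binomial n k ≡ n C k
binomial≡C zero    zero    = refl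
binomial≡C zero    (suc k) = refl
binomial≡C (suc n) zero    = refl
binomial≡C (suc n) (suc k) =
  trans (cong₂ _+_ (binomial≡C n k) (binomial≡C n (suc k))) (nCk+nC[k+1]≡[n+1]C[k+1] n k)

binomial-zeroʳ : ∀ n → binomial n 0 ≡ 1
binomial-zeroʳ zero    = refl
binomial-zeroʳ (suc n) = refl

binomial-> : ∀ {n k} → n < k → binomial n k ≡ 0
binomial-> {zero}  {suc k} _          = refl
binomial-> {suc n} {suc k} (s≤s n<k) = cong₂ _+_ (binomial-> n<k) (binomial-> (m<n⇒m<1+n n<k))

binomial-diag : ∀ n → binomial n n ≡ 1
binomial-diag zero    = refl
binomial-diag (suc n) = cong₂ _+_ (binomial-diag n) (binomial-> (n<1+n n))

binomial-pos : ∀ {n k} → k ≤ n → 0 < binomial n k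
binomial-pos {zero}  {zero}  _         = s≤s z≤n
binomial-pos {suc n} {zero}  _         = s≤s z≤n
binomial-pos {suc n} {suc k} (s≤s k≤n) = <-≤-trans (binomial-pos k≤n) (m≤m+n _ _)

binomial≡0⇒< : ∀ n k → binomial n k ≡ 0 → n < k
binomial≡0⇒< n k eq with k ≤? n
... | yes k≤n = ⊥-elim (<-irrefl (sym eq) (binomial-pos k≤n))
... | no  k≰n = ≰⇒> k≰n

binomial-factorials : ∀ x y → binomial (x + y) x * (x ! * y !) ≡ (x + y) !
binomial-factorials zero y =
  trans (cong (_* (1 * y !)) (binomial-zeroʳ y)) (trans (*-identityˡ _) (+-identityʳ _))
binomial-factorials (suc x) zero rewrite +-identityʳ x | binomial-diag x | binomial-> (n<1+n x) =
  trans (*-identityˡ _) (*-identityʳ _)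
binomial-factorials (suc x) (suc y) = begin
    (binomial (x + suc y) x + binomial (x + suc y) (suc x)) * (suc x ! * suc y !)
  ≡⟨ *-distribʳ-+ (suc x ! * suc y !) (binomial (x + suc y) x) _ ⟩
    binomial (x + suc y) x * (suc x ! * suc y !) + binomial (x + suc y) (suc x) * (suc x ! * suc y !)
  ≡⟨ cong₂ _+_ left right ⟩
    suc x * (x + suc y) ! + suc y * (x + suc y) !
  ≡⟨ sym (*-distribʳ-+ ((x + suc y) !) (suc x) (suc y)) ⟩
    suc (x + suc y) * (x + suc y) !
  ∎
  where
  open ≡-Reasoning
  left : binomial (x + suc y) x * (suc x ! * suc y !) ≡ suc x * (x + suc y) !
  left = trans (shuffle (binomial (x + suc y) x) (suc x) (x !) (suc y !))
               (cong (suc x *_) (binomial-factorials x (suc y)))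
    where
    shuffle : ∀ b a c d → b * ((a * c) * d) ≡ a * (b * (c * d))
    shuffle = solve-∀
  right : binomial (x + suc y) (suc x) * (suc x ! * suc y !) ≡ suc y * (x + suc y) !
  right rewrite +-suc x y =
    trans (shuffle (binomial (suc x + y) (suc x)) (suc x !) (suc y) (y !))
          (cong (suc y *_) (binomial-factorials (suc x) y))
    where
    shuffle : ∀ b a c d → b * (a * (c * d)) ≡ c * (b * (a * d))
    shuffle = solve-∀

trinomial : ℕ → ℕ → ℕ → ℕ
trinomial x y z = binomial (x + (y + z)) x * binomial (y + z) y

trinomial-factorials : ∀ x y z → trinomial x y z * (x ! * (y ! * z !)) ≡ (x + (y + z)) !
trinomial-factorials x y z =
  trans (shuffle (binomial (x + (y + z)) x) (binomial (y + z) y) (x !) (y ! * z !))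
        (trans (cong (λ w → binomial (x + (y + z)) x * (x ! * w)) (binomial-factorials y z))
               (binomial-factorials x (y + z)))
  where
  shuffle : ∀ a b c d → a * b * (c * d) ≡ a * (c * (b * d))
  shuffle = solve-∀

private
  factorial-nonZero : ∀ x y z → NonZero (x ! * (y ! * z !))
  factorial-nonZero x y z = m*n≢0 (x !) _ {{x !≢0}} {{m*n≢0 (y !) (z !) {{y !≢0}} {{z !≢0}}}}

trinomial-swap₁₂ : ∀ x y z → trinomial x y z ≡ trinomial y x z
trinomial-swap₁₂ x y z = *-cancelʳ-≡ _ _ (x ! * (y ! * z !)) {{factorial-nonZero x y z}} (begin
    trinomial x y z * (x ! * (y ! * z !))  ≡⟨ trinomial-factorials x y z ⟩
    (x + (y + z)) !                        ≡⟨ cong _! (x+[y+z]≡y+[x+z] x y z) ⟩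
    (y + (x + z)) !                        ≡⟨ sym (trinomial-factorials y x z) ⟩
    trinomial y x z * (y ! * (x ! * z !))  ≡⟨ cong (trinomial y x z *_) (x*[y*z]≡y*[x*z] (y !) (x !) (z !)) ⟩
    trinomial y x z * (x ! * (y ! * z !))  ∎)
  where
  open ≡-Reasoning
  x+[y+z]≡y+[x+z] : ∀ a b c → a + (b + c) ≡ b + (a + c)
  x+[y+z]≡y+[x+z] = solve-∀
  x*[y*z]≡y*[x*z] : ∀ a b c → a * (b * c) ≡ b * (a * c)
  x*[y*z]≡y*[x*z] = solve-∀

binomial-sym : ∀ x y → binomial (x + y) x ≡ binomial (x + y) y
binomial-sym x y = begin
    binomial (x + y) x                  ≡⟨ sym (*-identityʳ _) ⟩
    binomial (x + y) x * 1              ≡⟨ unfold x y ⟩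
    trinomial x y 0                     ≡⟨ trinomial-swap₁₂ x y 0 ⟩
    trinomial y x 0                     ≡⟨ sym (unfold y x) ⟩
    binomial (y + x) y * 1              ≡⟨ cong (λ n → binomial n y * 1) (+-comm y x) ⟩
    binomial (x + y) y * 1              ≡⟨ *-identityʳ _ ⟩
    binomial (x + y) y                  ∎
  where
  open ≡-Reasoning
  unfold : ∀ x y → binomial (x + y) x * 1 ≡ trinomial x y 0
  unfold x y rewrite +-identityʳ y | binomial-diag y = refl

trinomial-swap₂₃ : ∀ x y z → trinomial x y z ≡ trinomial x z y
trinomial-swap₂₃ x y z rewrite +-comm y z = cong (binomial (x + (z + y)) x *_) (sym (binomial-sym z y))

-- Choosing k of n elements and then a of the remaining n ∸ k is choosing a + k of them and then splitting.
binomial-subset-swap : ∀ n a k → binomial n k * binomial (n ∸ k) a ≡ binomial (a + k) k * binomial n (a + k)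
binomial-subset-swap n a k with a + k ≤? n
... | yes a+k≤n = begin
    binomial n k * binomial (n ∸ k) a
  ≡⟨ cong (λ z → binomial z k * binomial (z ∸ k) a) n≡k+[a+p] ⟩
    binomial (k + (a + p)) k * binomial (k + (a + p) ∸ k) a
  ≡⟨ cong (binomial (k + (a + p)) k *_) (cong (λ z → binomial z a) (m+n∸m≡n k (a + p))) ⟩
    trinomial k a p
  ≡⟨ trans (trinomial-swap₁₂ k a p) (trans (trinomial-swap₂₃ a k p) (trinomial-swap₁₂ a p k)) ⟩
    trinomial p a k
  ≡⟨ *-comm (binomial (p + (a + k)) p) (binomial (a + k) a) ⟩
    binomial (a + k) a * binomial (p + (a + k)) p
  ≡⟨ cong₂ _*_ (binomial-sym a k) (trans (binomial-sym p (a + k)) (cong (λ z → binomial z (a + k)) (m∸n+n≡m a+k≤n))) ⟩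
    binomial (a + k) k * binomial n (a + k)
  ∎
  where
  open ≡-Reasoning
  p = n ∸ (a + k)
  n≡k+[a+p] : n ≡ k + (a + p)
  n≡k+[a+p] = trans (sym (m∸n+n≡m a+k≤n)) (rearrange p a k)
    where
    rearrange : ∀ p a k → p + (a + k) ≡ k + (a + p)
    rearrange = solve-∀
... | no a+k≰n with k ≤? n
...   | no k≰n rewrite binomial-> (≰⇒> k≰n) | binomial-> (≰⇒> a+k≰n) = sym (*-zeroʳ (binomial (a + k) k))
...   | yes k≤n rewrite binomial-> (≰⇒> a+k≰n)
                  | binomial-> (+-cancelʳ-< k (n ∸ k) a (subst (_< a + k) (sym (m∸n+n≡m k≤n)) (≰⇒> a+k≰n))) =
  trans (*-zeroʳ (binomial n k)) (sym (*-zeroʳ (binomial (a + k) k)))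

sum-∷ʳ : ∀ xs k → sum (xs ∷ʳ k) ≡ sum xs + k
sum-∷ʳ xs k = trans (sum-++ xs (k ∷ [])) (cong (sum xs +_) (+-identityʳ k))

multinomial-∷ʳ : ∀ xs k → multinomial (xs ∷ʳ k) ≡ binomial (sum xs + k) k * multinomial xs
multinomial-∷ʳ [] k rewrite binomial-diag k | sym (binomial≡C (k + 0) k) | +-identityʳ k | binomial-diag k = refl
multinomial-∷ʳ (x ∷ xs) k = begin
    ((x + sum (xs ∷ʳ k)) C x) * multinomial (xs ∷ʳ k)
  ≡⟨ cong₂ _*_ (sym (binomial≡C _ x)) (multinomial-∷ʳ xs k) ⟩
    binomial (x + sum (xs ∷ʳ k)) x * (binomial (S + k) k * multinomial xs)
  ≡⟨ cong (λ z → binomial (x + z) x * (binomial (S + k) k * multinomial xs)) (sum-∷ʳ xs k) ⟩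
    binomial (x + (S + k)) x * (binomial (S + k) k * multinomial xs)
  ≡⟨ sym (*-assoc (binomial (x + (S + k)) x) _ _) ⟩
    binomial (x + (S + k)) x * binomial (S + k) k * multinomial xs
  ≡⟨ cong (λ z → binomial (x + z) x * binomial z k * multinomial xs) (+-comm S k) ⟩
    trinomial x k S * multinomial xs
  ≡⟨ cong (_* multinomial xs) (trinomial-swap₁₂ x k S) ⟩
    binomial (k + (x + S)) k * binomial (x + S) x * multinomial xs
  ≡⟨ cong (λ z → binomial z k * binomial (x + S) x * multinomial xs) (+-comm k (x + S)) ⟩
    binomial (x + S + k) k * binomial (x + S) x * multinomial xs
  ≡⟨ *-assoc (binomial (x + S + k) k) _ _ ⟩
    binomial (x + S + k) k * (binomial (x + S) x * multinomial xs)
  ≡⟨ cong (λ z → binomial (x + S + k) k * (z * multinomial xs)) (binomial≡C (x + S) x) ⟩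
    binomial (x + S + k) k * (((x + S) C x) * multinomial xs)
  ∎
  where
  open ≡-Reasoning
  S = sum xs

∑ : {A : Set} → List A → (A → ℕ) → ℕ
∑ xs f = sum (map f xs)

module _ {A : Set} where

  ∑-cong : ∀ (xs : List A) {f g} → (∀ x → f x ≡ g x) → ∑ xs f ≡ ∑ xs g
  ∑-cong xs eq = cong sum (map-cong eq xs)

  ∑-cong-All : ∀ {xs : List A} {f g} → All (λ x → f x ≡ g x) xs → ∑ xs f ≡ ∑ xs g
  ∑-cong-All []         = refl
  ∑-cong-All (eq ∷ eqs) = cong₂ _+_ eq (∑-cong-All eqs)

  ∑-++ : ∀ (xs ys : List A) f → ∑ (xs ++ ys) f ≡ ∑ xs f + ∑ ys f
  ∑-++ xs ys f = trans (cong sum (map-++ f xs ys)) (sum-++ (map f xs) (map f ys))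

  ∑-+ : ∀ (xs : List A) f g → ∑ xs (λ x → f x + g x) ≡ ∑ xs f + ∑ xs g
  ∑-+ []       f g = refl
  ∑-+ (x ∷ xs) f g = trans (cong (f x + g x +_) (∑-+ xs f g)) (+-+-comm (f x) (g x) (∑ xs f) (∑ xs g))
    where
    +-+-comm : ∀ a b c d → a + b + (c + d) ≡ a + c + (b + d)
    +-+-comm = solve-∀

  ∑-*ˡ : ∀ (xs : List A) c f → ∑ xs (λ x → c * f x) ≡ c * ∑ xs f
  ∑-*ˡ []       c f = sym (*-zeroʳ c)
  ∑-*ˡ (x ∷ xs) c f = trans (cong (c * f x +_) (∑-*ˡ xs c f)) (sym (*-distribˡ-+ c (f x) (∑ xs f)))

  ∑-zero : ∀ (xs : List A) {f} → (∀ x → f x ≡ 0) → ∑ xs f ≡ 0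
  ∑-zero []       eq = refl
  ∑-zero (x ∷ xs) eq = cong₂ _+_ (eq x) (∑-zero xs eq)

  ∑-if : ∀ (xs : List A) b f → ∑ xs (λ x → if b then f x else 0) ≡ (if b then ∑ xs f else 0)
  ∑-if xs true  f = refl
  ∑-if xs false f = ∑-zero xs (λ _ → refl)

  ∑-filter : ∀ (p : A → Bool) xs f → ∑ (filter (T? ∘ p) xs) f ≡ ∑ xs (λ x → if p x then f x else 0)
  ∑-filter p []       f = refl
  ∑-filter p (x ∷ xs) f with p x
  ... | true  = cong (f x +_) (∑-filter p xs f)
  ... | false = ∑-filter p xs f

  ∑≡0⇒All : ∀ (xs : List A) f → ∑ xs f ≡ 0 → All (λ x → f x ≡ 0) xs
  ∑≡0⇒All []       f eq = []
  ∑≡0⇒All (x ∷ xs) f eq = m+n≡0⇒m≡0 (f x) eq ∷ ∑≡0⇒All xs f (m+n≡0⇒n≡0 (f x) eq)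

  length≡∑1 : ∀ (xs : List A) → length xs ≡ ∑ xs (λ _ → 1)
  length≡∑1 []       = refl
  length≡∑1 (x ∷ xs) = cong suc (length≡∑1 xs)

∑-map : ∀ {A B : Set} (xs : List A) (h : A → B) f → ∑ (map h xs) f ≡ ∑ xs (f ∘ h)
∑-map xs h f = cong sum (sym (map-∘ xs))

∑-concat : ∀ {A : Set} (xss : List (List A)) f → ∑ (concat xss) f ≡ ∑ xss (λ xs → ∑ xs f)
∑-concat []         f = refl
∑-concat (xs ∷ xss) f = trans (∑-++ xs (concat xss) f) (cong (∑ xs f +_) (∑-concat xss f))

All-filter : ∀ {A : Set} {P : A → Set} (p : A → Bool) {xs} → All P xs → All P (filter (T? ∘ p) xs)
All-filter p {[]}     []         = []
All-filter p {x ∷ xs} (px ∷ pxs) with p x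
... | true  = px ∷ All-filter p pxs
... | false = All-filter p pxs

≡ᵇ-refl : ∀ n → (n ≡ᵇ n) ≡ true
≡ᵇ-refl zero    = refl
≡ᵇ-refl (suc n) = ≡ᵇ-refl n

≡ᵇ≡true⇒≡ : ∀ {m n} → (m ≡ᵇ n) ≡ true → m ≡ n
≡ᵇ≡true⇒≡ {m} {n} eq = ≡ᵇ⇒≡ m n (subst T (sym eq) _)

≢⇒≡ᵇ≡false : ∀ {m n} → m ≢ n → (m ≡ᵇ n) ≡ false
≢⇒≡ᵇ≡false {m} {n} m≢n with m ≡ᵇ n in eq
... | true  = ⊥-elim (m≢n (≡ᵇ≡true⇒≡ eq))
... | false = refl

<⇒<ᵇ≡true : ∀ {m n} → m < n → (m <ᵇ n) ≡ true
<⇒<ᵇ≡true {zero}  (s≤s _)   = refl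
<⇒<ᵇ≡true {suc m} (s≤s m<n) = <⇒<ᵇ≡true m<n

≥⇒<ᵇ≡false : ∀ {m n} → n ≤ m → (m <ᵇ n) ≡ false
≥⇒<ᵇ≡false z≤n       = refl
≥⇒<ᵇ≡false (s≤s n≤m) = ≥⇒<ᵇ≡false n≤m

module Insertion (ℓ : ℕ) where

  -- insert k u lists the shuffles of u with ℓᵏ, each exactly once.
  insert : ℕ → List ℕ → List (List ℕ)
  insert zero    u       = u ∷ []
  insert (suc k) []      = (ℓ ∷ replicate k ℓ) ∷ []
  insert (suc k) (d ∷ u) = map (d ∷_) (insert (suc k) u) ++ map (ℓ ∷_) (insert k (d ∷ u))

  onInsertions : ℕ → (List ℕ → ℕ) → List ℕ → ℕ
  onInsertions k g v = ∑ (insert k v) g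

  insert-[] : ∀ k → insert k [] ≡ replicate k ℓ ∷ []
  insert-[] zero    = refl
  insert-[] (suc k) = refl

  ∑-insert-∷ : ∀ k d u f →
    ∑ (insert (suc k) (d ∷ u)) f ≡ ∑ (insert (suc k) u) (f ∘ (d ∷_)) + ∑ (insert k (d ∷ u)) (f ∘ (ℓ ∷_))
  ∑-insert-∷ k d u f = trans (∑-++ (map (d ∷_) (insert (suc k) u)) _ f)
    (cong₂ _+_ (∑-map (insert (suc k) u) (d ∷_) f) (∑-map (insert k (d ∷ u)) (ℓ ∷_) f))

module DescentRuns (X : ℕ → Bool) where

  -- run g w sums g over the suffixes of w obtained by deleting an initial segment w₁ ⋯ wⱼ
  -- in which every letter except possibly wⱼ begins an X-descent.
  runFrom : ℕ → (List ℕ → ℕ) → List ℕ → ℕ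
  runFrom c g []      = g []
  runFrom c g (d ∷ w) = g (d ∷ w) + (if (d <ᵇ c) ∧ X c then runFrom d g w else 0)

  run : (List ℕ → ℕ) → List ℕ → ℕ
  run g []      = g []
  run g (c ∷ w) = g (c ∷ w) + runFrom c g w

  runFrom-cong : ∀ b c {f g} u → (∀ v → All (_< b) v → f v ≡ g v) → All (_< b) u → runFrom c f u ≡ runFrom c g u
  runFrom-cong b c []      eq _              = eq [] []
  runFrom-cong b c (d ∷ u) eq bu@(_ ∷ bu′) with (d <ᵇ c) ∧ X c
  ... | true  = cong₂ _+_ (eq (d ∷ u) bu) (runFrom-cong b d u eq bu′)
  ... | false = cong (_+ 0) (eq (d ∷ u) bu)

  run-cong : ∀ b {f g} u → (∀ v → All (_< b) v → f v ≡ g v) → All (_< b) u → run f u ≡ run g u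
  run-cong b []      eq _              = eq [] []
  run-cong b (c ∷ u) eq bu@(_ ∷ bu′) = cong₂ _+_ (eq (c ∷ u) bu) (runFrom-cong b c u eq bu′)

  runFrom-*ˡ : ∀ c a f u → runFrom c (λ v → a * f v) u ≡ a * runFrom c f u
  runFrom-*ˡ c a f []      = refl
  runFrom-*ˡ c a f (d ∷ u) with (d <ᵇ c) ∧ X c
  ... | true  = trans (cong (a * f (d ∷ u) +_) (runFrom-*ˡ d a f u)) (sym (*-distribˡ-+ a _ _))
  ... | false = trans (cong (a * f (d ∷ u) +_) (sym (*-zeroʳ a))) (sym (*-distribˡ-+ a _ 0))

  run-*ˡ : ∀ a f u → run (λ v → a * f v) u ≡ a * run f u
  run-*ˡ a f []      = refl
  run-*ˡ a f (c ∷ u) = trans (cong (a * f (c ∷ u) +_) (runFrom-*ˡ c a f u)) (sym (*-distribˡ-+ a _ _))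

  weight : ℕ → List ℕ → ℕ
  weight t w = binomial (t + desX X w) (length w)

  runFrom-weight : ∀ t c w → runFrom c (weight t) w ≡ binomial (t + desX X (c ∷ w)) (length w)
  runFrom-weight t c []      = refl
  runFrom-weight t c (d ∷ w) with (d <ᵇ c) ∧ X c
  ... | true  = trans (cong (weight t (d ∷ w) +_) (runFrom-weight t d w))
                      (trans (+-comm (weight t (d ∷ w)) _)
                             (cong (λ z → binomial z (suc (length w))) (sym (+-suc t (desX X (d ∷ w))))))
  ... | false = +-identityʳ _

  weight-suc : ∀ t w → weight (suc t) w ≡ run (weight t) w
  weight-suc t []      = sym (binomial-zeroʳ (t + 0))
  weight-suc t (c ∷ w) =
    trans (+-comm (binomial (t + desX X (c ∷ w)) (length w)) _) (cong (weight t (c ∷ w) +_) (sym (runFrom-weight t c w)))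

  desX-∷-≤ : ∀ x w → desX X (x ∷ w) ≤ length w
  desX-∷-≤ x []      = z≤n
  desX-∷-≤ x (y ∷ w) with (y <ᵇ x) ∧ X x
  ... | true  = s≤s (desX-∷-≤ y w)
  ... | false = m≤n⇒m≤1+n (desX-∷-≤ y w)

  desX-≤ : ∀ w → desX X w ≤ length w
  desX-≤ []      = z≤n
  desX-≤ (x ∷ w) = m≤n⇒m≤1+n (desX-∷-≤ x w)

  weight-zero-∷ : ∀ x w → weight 0 (x ∷ w) ≡ 0
  weight-zero-∷ x w = binomial-> (s≤s (desX-∷-≤ x w))

module InsertMaximum (X : ℕ → Bool) (ℓ : ℕ) where

  open Insertion ℓ
  open DescentRuns X

  ∑-insert-runFrom : ∀ c g k u → ((ℓ <ᵇ c) ∧ X c) ≡ false → All (_< ℓ) u →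
    ∑ (insert k u) (runFrom c g) ≡ runFrom c (onInsertions k g) u
  ∑-insert-runFrom c g zero u _ bu =
    trans (+-identityʳ _) (runFrom-cong ℓ c u (λ v _ → sym (+-identityʳ (g v))) bu)
  ∑-insert-runFrom c g (suc k) [] ℓc-no-descent _ rewrite ℓc-no-descent = +-identityʳ _
  ∑-insert-runFrom c g (suc k) (d ∷ u) ℓc-no-descent (d<ℓ ∷ bu) = begin
      ∑ (insert (suc k) (d ∷ u)) (runFrom c g)
    ≡⟨ ∑-insert-∷ k d u (runFrom c g) ⟩
      ∑ (insert (suc k) u) (runFrom c g ∘ (d ∷_)) + ∑ (insert k (d ∷ u)) (runFrom c g ∘ (ℓ ∷_))
    ≡⟨ cong₂ _+_ after-d after-ℓ ⟩
      (∑ (insert (suc k) u) (g ∘ (d ∷_)) + descent) + ∑ (insert k (d ∷ u)) (g ∘ (ℓ ∷_))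
    ≡⟨ +-comm-middle (∑ (insert (suc k) u) (g ∘ (d ∷_))) descent (∑ (insert k (d ∷ u)) (g ∘ (ℓ ∷_))) ⟩
      (∑ (insert (suc k) u) (g ∘ (d ∷_)) + ∑ (insert k (d ∷ u)) (g ∘ (ℓ ∷_))) + descent
    ≡⟨ cong (_+ descent) (sym (∑-insert-∷ k d u g)) ⟩
      runFrom c (onInsertions (suc k) g) (d ∷ u)
    ∎
    where
    open ≡-Reasoning
    descent = if (d <ᵇ c) ∧ X c then runFrom d (onInsertions (suc k) g) u else 0
    +-comm-middle : ∀ a b c → a + b + c ≡ a + c + b
    +-comm-middle = solve-∀
    ℓd-no-descent : ((ℓ <ᵇ d) ∧ X d) ≡ false
    ℓd-no-descent rewrite ≥⇒<ᵇ≡false (<⇒≤ d<ℓ) = refl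
    after-d : ∑ (insert (suc k) u) (runFrom c g ∘ (d ∷_)) ≡ ∑ (insert (suc k) u) (g ∘ (d ∷_)) + descent
    after-d = trans (∑-+ (insert (suc k) u) _ _) (cong (∑ (insert (suc k) u) (g ∘ (d ∷_)) +_)
      (trans (∑-if (insert (suc k) u) _ (runFrom d g))
             (cong (λ z → if (d <ᵇ c) ∧ X c then z else 0) (∑-insert-runFrom d g (suc k) u ℓd-no-descent bu))))
    after-ℓ : ∑ (insert k (d ∷ u)) (runFrom c g ∘ (ℓ ∷_)) ≡ ∑ (insert k (d ∷ u)) (g ∘ (ℓ ∷_))
    after-ℓ = ∑-cong (insert k (d ∷ u)) λ w →
      trans (cong (λ b → g (ℓ ∷ w) + (if b then runFrom ℓ g w else 0)) ℓc-no-descent) (+-identityʳ _)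

  ℓℓ-no-descent : ((ℓ <ᵇ ℓ) ∧ X ℓ) ≡ false
  ℓℓ-no-descent rewrite ≥⇒<ᵇ≡false (≤-refl {ℓ}) = refl

  runFrom-replicate : ∀ g k → runFrom ℓ g (replicate k ℓ) ≡ g (replicate k ℓ)
  runFrom-replicate g zero    = refl
  runFrom-replicate g (suc k) rewrite ≥⇒<ᵇ≡false (≤-refl {ℓ}) = +-identityʳ _

  ∑-insert-run : ∀ g k u → All (_< ℓ) u →
    ∑ (insert (suc k) u) (run g) ≡ run (onInsertions (suc k) g) u + runFrom ℓ (onInsertions k g) u
  ∑-insert-run g k [] _ rewrite insert-[] k | runFrom-replicate g k = +-+-identityʳ (g (ℓ ∷ replicate k ℓ)) _
    where
    +-+-identityʳ : ∀ a b → a + b + 0 ≡ a + 0 + (b + 0)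
    +-+-identityʳ = solve-∀
  ∑-insert-run g k (d ∷ u) bu@(d<ℓ ∷ bu′) = begin
      ∑ (insert (suc k) (d ∷ u)) (run g)
    ≡⟨ ∑-insert-∷ k d u (run g) ⟩
      ∑ (insert (suc k) u) (run g ∘ (d ∷_)) + ∑ (insert k (d ∷ u)) (run g ∘ (ℓ ∷_))
    ≡⟨ cong₂ _+_ (∑-+ (insert (suc k) u) _ _) (∑-+ (insert k (d ∷ u)) _ _) ⟩
      (A + ∑ (insert (suc k) u) (runFrom d g)) + (B + ∑ (insert k (d ∷ u)) (runFrom ℓ g))
    ≡⟨ cong₂ (λ p q → (A + p) + (B + q)) (∑-insert-runFrom d g (suc k) u ℓd-no-descent bu′)
                                         (∑-insert-runFrom ℓ g k (d ∷ u) ℓℓ-no-descent bu) ⟩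
      (A + runFrom d (onInsertions (suc k) g) u) + (B + runFrom ℓ (onInsertions k g) (d ∷ u))
    ≡⟨ regroup A _ B _ ⟩
      ((A + B) + runFrom d (onInsertions (suc k) g) u) + runFrom ℓ (onInsertions k g) (d ∷ u)
    ≡⟨ cong (λ p → (p + runFrom d (onInsertions (suc k) g) u) + runFrom ℓ (onInsertions k g) (d ∷ u))
            (sym (∑-insert-∷ k d u g)) ⟩
      run (onInsertions (suc k) g) (d ∷ u) + runFrom ℓ (onInsertions k g) (d ∷ u)
    ∎
    where
    open ≡-Reasoning
    A = ∑ (insert (suc k) u) (g ∘ (d ∷_))
    B = ∑ (insert k (d ∷ u)) (g ∘ (ℓ ∷_))
    regroup : ∀ a b c d → a + b + (c + d) ≡ a + c + b + d
    regroup = solve-∀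
    ℓd-no-descent : ((ℓ <ᵇ d) ∧ X d) ≡ false
    ℓd-no-descent rewrite ≥⇒<ᵇ≡false (<⇒≤ d<ℓ) = refl

  runFrom-max-∈X : X ℓ ≡ true → ∀ f u → All (_< ℓ) u → runFrom ℓ f u ≡ run f u
  runFrom-max-∈X ℓ∈X f []      _          = refl
  runFrom-max-∈X ℓ∈X f (d ∷ u) (d<ℓ ∷ _) rewrite <⇒<ᵇ≡true d<ℓ | ℓ∈X = refl

  runFrom-max-∉X : X ℓ ≡ false → ∀ f u → runFrom ℓ f u ≡ f u
  runFrom-max-∉X ℓ∉X f []      = refl
  runFrom-max-∉X ℓ∉X f (d ∷ u) rewrite ℓ∉X | ∧-zeroʳ (d <ᵇ ℓ) = +-identityʳ _

  ∑-insert-weight-zero : ∀ k u → ∑ (insert (suc k) u) (weight 0) ≡ 0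
  ∑-insert-weight-zero k []      = cong (_+ 0) (weight-zero-∷ ℓ (replicate k ℓ))
  ∑-insert-weight-zero k (d ∷ u) = trans (∑-insert-∷ k d u (weight 0))
    (cong₂ _+_ (∑-zero (insert (suc k) u) (weight-zero-∷ d)) (∑-zero (insert k (d ∷ u)) (weight-zero-∷ ℓ)))

  ∑-insert-weight-∈X : X ℓ ≡ true → ∀ t k u → All (_< ℓ) u → ∑ (insert k u) (weight t) ≡ binomial t k * weight t u
  ∑-insert-weight-∈X ℓ∈X t zero u _ =
    trans (+-identityʳ _) (sym (trans (cong (_* weight t u) (binomial-zeroʳ t)) (*-identityˡ _)))
  ∑-insert-weight-∈X ℓ∈X zero (suc k) u _ = ∑-insert-weight-zero k u
  ∑-insert-weight-∈X ℓ∈X (suc t) (suc k) u bu = begin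
      ∑ (insert (suc k) u) (weight (suc t))
    ≡⟨ ∑-cong (insert (suc k) u) (weight-suc t) ⟩
      ∑ (insert (suc k) u) (run (weight t))
    ≡⟨ ∑-insert-run (weight t) k u bu ⟩
      run (onInsertions (suc k) (weight t)) u + runFrom ℓ (onInsertions k (weight t)) u
    ≡⟨ cong (run (onInsertions (suc k) (weight t)) u +_) (runFrom-max-∈X ℓ∈X _ u bu) ⟩
      run (onInsertions (suc k) (weight t)) u + run (onInsertions k (weight t)) u
    ≡⟨ cong₂ _+_ (run-cong ℓ u (λ v bv → ∑-insert-weight-∈X ℓ∈X t (suc k) v bv) bu)
                 (run-cong ℓ u (λ v bv → ∑-insert-weight-∈X ℓ∈X t k v bv) bu) ⟩
      run (λ v → binomial t (suc k) * weight t v) u + run (λ v → binomial t k * weight t v) u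
    ≡⟨ cong₂ _+_ (run-*ˡ (binomial t (suc k)) (weight t) u) (run-*ˡ (binomial t k) (weight t) u) ⟩
      binomial t (suc k) * run (weight t) u + binomial t k * run (weight t) u
    ≡⟨ sym (*-distribʳ-+ (run (weight t) u) (binomial t (suc k)) (binomial t k)) ⟩
      (binomial t (suc k) + binomial t k) * run (weight t) u
    ≡⟨ cong₂ _*_ (+-comm (binomial t (suc k)) (binomial t k)) (sym (weight-suc t u)) ⟩
      binomial (suc t) (suc k) * weight (suc t) u
    ∎
    where open ≡-Reasoning

  ∑-insert-weight-∉X : X ℓ ≡ false → ∀ t k u → All (_< ℓ) u → ∑ (insert k u) (weight t) ≡ binomial t k * weight (t ∸ k) u
  ∑-insert-weight-∉X ℓ∉X t zero u _ =
    trans (+-identityʳ _) (sym (trans (cong (_* weight t u) (binomial-zeroʳ t)) (*-identityˡ _)))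
  ∑-insert-weight-∉X ℓ∉X zero (suc k) u _ = ∑-insert-weight-zero k u
  ∑-insert-weight-∉X ℓ∉X (suc t) (suc k) u bu = begin
      ∑ (insert (suc k) u) (weight (suc t))
    ≡⟨ ∑-cong (insert (suc k) u) (weight-suc t) ⟩
      ∑ (insert (suc k) u) (run (weight t))
    ≡⟨ ∑-insert-run (weight t) k u bu ⟩
      run (onInsertions (suc k) (weight t)) u + runFrom ℓ (onInsertions k (weight t)) u
    ≡⟨ cong (run (onInsertions (suc k) (weight t)) u +_) (runFrom-max-∉X ℓ∉X _ u) ⟩
      run (onInsertions (suc k) (weight t)) u + onInsertions k (weight t) u
    ≡⟨ cong₂ _+_ (run-cong ℓ u (λ v bv → ∑-insert-weight-∉X ℓ∉X t (suc k) v bv) bu) (∑-insert-weight-∉X ℓ∉X t k u bu) ⟩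
      run (λ v → binomial t (suc k) * weight (t ∸ suc k) v) u + binomial t k * weight (t ∸ k) u
    ≡⟨ cong (_+ binomial t k * weight (t ∸ k) u) (run-*ˡ (binomial t (suc k)) (weight (t ∸ suc k)) u) ⟩
      binomial t (suc k) * run (weight (t ∸ suc k)) u + binomial t k * weight (t ∸ k) u
    ≡⟨ pascal ⟩
      binomial (suc t) (suc k) * weight (t ∸ k) u
    ∎
    where
    open ≡-Reasoning
    pascal : binomial t (suc k) * run (weight (t ∸ suc k)) u + binomial t k * weight (t ∸ k) u
           ≡ binomial (suc t) (suc k) * weight (t ∸ k) u
    pascal with k <? t
    ... | yes k<t = begin
        binomial t (suc k) * run (weight (t ∸ suc k)) u + binomial t k * weight (t ∸ k) u
      ≡⟨ cong (λ z → binomial t (suc k) * z + binomial t k * weight (t ∸ k) u) (trans (sym (weight-suc (t ∸ suc k) u))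
                                                        (cong (λ z → weight z u) (sym (+-∸-assoc 1 k<t)))) ⟩
        binomial t (suc k) * weight (t ∸ k) u + binomial t k * weight (t ∸ k) u
      ≡⟨ sym (*-distribʳ-+ (weight (t ∸ k) u) (binomial t (suc k)) (binomial t k)) ⟩
        (binomial t (suc k) + binomial t k) * weight (t ∸ k) u
      ≡⟨ cong (_* weight (t ∸ k) u) (+-comm (binomial t (suc k)) (binomial t k)) ⟩
        binomial (suc t) (suc k) * weight (t ∸ k) u
      ∎
    ... | no k≮t rewrite binomial-> (s≤s (≮⇒≥ k≮t)) = cong (_* weight (t ∸ k) u) (sym (+-identityʳ (binomial t k)))

range1≡applyUpTo : ∀ m → range1 m ≡ applyUpTo suc m
range1≡applyUpTo m = map-applyUpTo id suc m

All-range1 : ∀ {P : ℕ → Set} m → (∀ c → c < m → P (suc c)) → All P (range1 m)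
All-range1 {P} m Pc rewrite range1≡applyUpTo m = All.applyUpTo⁺₁ suc m (λ {i} i<m → Pc i i<m)

∈-range1 : ∀ {c m} → c < m → suc c ∈ range1 m
∈-range1 {c} {m} c<m = subst (suc c ∈_) (sym (range1≡applyUpTo m)) (∈-applyUpTo⁺ suc c<m)

range1-suc : ∀ m → range1 (suc m) ≡ range1 m ∷ʳ suc m
range1-suc m = trans (cong (map suc) (sym (applyUpTo-∷ʳ id m))) (map-++ suc (upTo m) (m ∷ []))

range1-length-∷ʳ : ∀ (ρ : List ℕ) k → range1 (length (ρ ∷ʳ k)) ≡ range1 (length ρ) ∷ʳ suc (length ρ)
range1-length-∷ʳ ρ k = trans (cong range1 (length-∷ʳ ρ k)) (range1-suc (length ρ))
  where
  length-∷ʳ : ∀ (ρ : List ℕ) k → length (ρ ∷ʳ k) ≡ suc (length ρ)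
  length-∷ʳ ρ k = trans (length-++ ρ) (+-comm (length ρ) 1)

filter-range1-∷ʳ : ∀ (p : ℕ → Bool) ρ k →
  filter (T? ∘ p) (range1 (length (ρ ∷ʳ k)))
    ≡ filter (T? ∘ p) (range1 (length ρ)) ++ (if p (suc (length ρ)) then suc (length ρ) ∷ [] else [])
filter-range1-∷ʳ p ρ k rewrite range1-length-∷ʳ ρ k | filter-++ (T? ∘ p) (range1 (length ρ)) (suc (length ρ) ∷ [])
  with p (suc (length ρ))
... | true  = refl
... | false = refl

positive : ℕ → Bool
positive zero    = false
positive (suc _) = true

decrement : List ℕ → ℕ → List ℕ
decrement []       _             = []
decrement (k ∷ ks) zero          = k ∷ ks
decrement (k ∷ ks) (suc zero)    = (k ∸ 1) ∷ ks
decrement (k ∷ ks) (suc (suc c)) = k ∷ decrement ks (suc c)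

part-decrement : ∀ ρ x c → part (decrement ρ c) x ≡ (if x ≡ᵇ c then part ρ x ∸ 1 else part ρ x)
part-decrement []       x             c with x ≡ᵇ c
... | true  = refl
... | false = refl
part-decrement (k ∷ ks) zero          zero          = refl
part-decrement (k ∷ ks) zero          (suc zero)    = refl
part-decrement (k ∷ ks) zero          (suc (suc c)) = refl
part-decrement (k ∷ ks) (suc zero)    zero          = refl
part-decrement (k ∷ ks) (suc zero)    (suc zero)    = refl
part-decrement (k ∷ ks) (suc zero)    (suc (suc c)) = refl
part-decrement (k ∷ ks) (suc (suc x)) zero          = refl
part-decrement (k ∷ ks) (suc (suc x)) (suc zero)    = refl
part-decrement (k ∷ ks) (suc (suc x)) (suc (suc c)) = part-decrement ks (suc x) (suc c)

length-decrement : ∀ ρ c → length (decrement ρ c) ≡ length ρ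
length-decrement []       c             = refl
length-decrement (k ∷ ks) zero          = refl
length-decrement (k ∷ ks) (suc zero)    = refl
length-decrement (k ∷ ks) (suc (suc c)) = cong suc (length-decrement ks (suc c))

sum-decrement : ∀ ρ c → positive (part ρ c) ≡ true → suc (sum (decrement ρ c)) ≡ sum ρ
sum-decrement []           c             ()
sum-decrement (k ∷ ks)     zero          ()
sum-decrement (zero ∷ ks)  (suc zero)    ()
sum-decrement (suc k ∷ ks) (suc zero)    _   = refl
sum-decrement (k ∷ ks)     (suc (suc c)) pos = trans (sym (+-suc k _)) (cong (k +_) (sum-decrement ks (suc c) pos))

decrement-∷ʳ : ∀ ρ c k → 1 ≤ c → c ≤ length ρ → decrement (ρ ∷ʳ k) c ≡ decrement ρ c ∷ʳ k
decrement-∷ʳ (k′ ∷ ks) (suc zero)    k _ _         = refl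
decrement-∷ʳ (k′ ∷ ks) (suc (suc c)) k _ (s≤s c≤) = cong (k′ ∷_) (decrement-∷ʳ ks (suc c) k (s≤s z≤n) c≤)

decrement-last : ∀ ρ k → decrement (ρ ∷ʳ suc k) (suc (length ρ)) ≡ ρ ∷ʳ k
decrement-last []        k = refl
decrement-last (k′ ∷ ks) k = cong (k′ ∷_) (decrement-last ks k)

part-∷ʳ : ∀ ρ c k → c ≤ length ρ → part (ρ ∷ʳ k) c ≡ part ρ c
part-∷ʳ []        zero          k _          = refl
part-∷ʳ (k′ ∷ ks) zero          k _          = refl
part-∷ʳ (k′ ∷ ks) (suc zero)    k _          = refl
part-∷ʳ (k′ ∷ ks) (suc (suc c)) k (s≤s c≤) = part-∷ʳ ks (suc c) k c≤

part-last : ∀ ρ k → part (ρ ∷ʳ k) (suc (length ρ)) ≡ k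
part-last []        k = refl
part-last (k′ ∷ ks) k = part-last ks k

map-part-∷ʳ : ∀ ρ k {xs} → All (_≤ length ρ) xs → map (part (ρ ∷ʳ k)) xs ≡ map (part ρ) xs
map-part-∷ʳ ρ k bounded = map-cong-local (All.map (λ {x} → part-∷ʳ ρ x k) bounded)

sum≡0⇒part≡0 : ∀ ρ → sum ρ ≡ 0 → ∀ x → part ρ x ≡ 0
sum≡0⇒part≡0 []       _  x             = refl
sum≡0⇒part≡0 (k ∷ ks) _  zero          = refl
sum≡0⇒part≡0 (k ∷ ks) eq (suc zero)    = m+n≡0⇒m≡0 k eq
sum≡0⇒part≡0 (k ∷ ks) eq (suc (suc x)) = sum≡0⇒part≡0 ks (m+n≡0⇒n≡0 k eq) (suc x)

and-map-∧ : ∀ {A : Set} (xs : List A) p q → and (map (λ x → p x ∧ q x) xs) ≡ and (map p xs) ∧ and (map q xs)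
and-map-∧ []       p q = refl
and-map-∧ (x ∷ xs) p q = trans (cong ((p x ∧ q x) ∧_) (and-map-∧ xs p q)) (∧-∧-comm (p x) (q x) _ _)
  where
  ∧-∧-comm : ∀ a b c d → (a ∧ b) ∧ (c ∧ d) ≡ (a ∧ c) ∧ (b ∧ d)
  ∧-∧-comm false b     c     d = refl
  ∧-∧-comm true  false false d = refl
  ∧-∧-comm true  false true  d = refl
  ∧-∧-comm true  true  c     d = refl

and-map-true : ∀ {A : Set} (xs : List A) p → (∀ x → p x ≡ true) → and (map p xs) ≡ true
and-map-true []       p eq = refl
and-map-true (x ∷ xs) p eq rewrite eq x = and-map-true xs p eq

and-map-at : ∀ c b xs → c ∈ xs → and (map (λ x → if x ≡ᵇ c then b else true) xs) ≡ b
and-map-at c true  xs        _ = and-map-true xs _ λ x → if-same (x ≡ᵇ c)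
  where
  if-same : ∀ a → (if a then true else true) ≡ true
  if-same true  = refl
  if-same false = refl
and-map-at c false (x ∷ xs) (here refl) rewrite ≡ᵇ-refl c = refl
and-map-at c false (x ∷ xs) (there c∈xs) rewrite and-map-at c false xs c∈xs with x ≡ᵇ c
... | true  = refl
... | false = refl

isRearr-∷ : ∀ ρ c w → 1 ≤ c → c ≤ length ρ → isRearr ρ (c ∷ w) ≡ positive (part ρ c) ∧ isRearr (decrement ρ c) w
isRearr-∷ ρ (suc c) w _ c<m = begin
    and (map (λ x → count x (suc c ∷ w) ≡ᵇ part ρ x) (range1 (length ρ)))
  ≡⟨ cong and (map-cong count-∷ (range1 (length ρ))) ⟩
    and (map (λ x → (if x ≡ᵇ suc c then positive (part ρ (suc c)) else true) ∧ (count x w ≡ᵇ part ρ′ x)) (range1 (length ρ)))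
  ≡⟨ and-map-∧ (range1 (length ρ)) _ _ ⟩
    and (map (λ x → if x ≡ᵇ suc c then positive (part ρ (suc c)) else true) (range1 (length ρ)))
      ∧ and (map (λ x → count x w ≡ᵇ part ρ′ x) (range1 (length ρ)))
  ≡⟨ cong₂ _∧_ (and-map-at (suc c) _ (range1 (length ρ)) (∈-range1 c<m))
               (cong (λ m → and (map (λ x → count x w ≡ᵇ part ρ′ x) (range1 m))) (sym (length-decrement ρ (suc c)))) ⟩
    positive (part ρ (suc c)) ∧ isRearr ρ′ w
  ∎
  where
  open ≡-Reasoning
  ρ′ = decrement ρ (suc c)
  suc≡ᵇ : ∀ n p → (suc n ≡ᵇ p) ≡ positive p ∧ (n ≡ᵇ p ∸ 1)
  suc≡ᵇ n zero    = refl
  suc≡ᵇ n (suc p) = refl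
  count-∷ : ∀ x → (count x (suc c ∷ w) ≡ᵇ part ρ x)
                ≡ (if x ≡ᵇ suc c then positive (part ρ (suc c)) else true) ∧ (count x w ≡ᵇ part ρ′ x)
  count-∷ x rewrite part-decrement ρ x (suc c) with x ≡ᵇ suc c in x≡c
  ... | true  = trans (suc≡ᵇ (count x w) (part ρ x))
                      (cong (λ z → positive (part ρ z) ∧ (count x w ≡ᵇ part ρ x ∸ 1)) (≡ᵇ≡true⇒≡ x≡c))
  ... | false = refl

∑-R≡∑-words : ∀ ρ f → ∑ (R ρ) f ≡ ∑ (words (length ρ) (sum ρ)) (λ w → if isRearr ρ w then f w else 0)
∑-R≡∑-words ρ f = ∑-filter (isRearr ρ) (words (length ρ) (sum ρ)) f

∑-R-empty : ∀ ρ → sum ρ ≡ 0 → ∀ f → ∑ (R ρ) f ≡ f [] + 0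
∑-R-empty ρ ρ≡0 f rewrite ∑-R≡∑-words ρ f | ρ≡0
  | and-map-true (range1 (length ρ)) _ (λ x → cong (0 ≡ᵇ_) (sum≡0⇒part≡0 ρ ρ≡0 x)) = refl

startingWith : List ℕ → (List ℕ → ℕ) → ℕ → ℕ
startingWith ρ f c = if positive (part ρ c) then ∑ (R (decrement ρ c)) (f ∘ (c ∷_)) else 0

∑-words-∷ : ∀ ρ n → sum ρ ≡ suc n → ∀ f c → 1 ≤ c → c ≤ length ρ →
  ∑ (map (c ∷_) (words (length ρ) n)) (λ w → if isRearr ρ w then f w else 0) ≡ startingWith ρ f c
∑-words-∷ ρ n ρ≡1+n f c 1≤c c≤m = begin
    ∑ (map (c ∷_) (words (length ρ) n)) (λ w → if isRearr ρ w then f w else 0)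
  ≡⟨ ∑-map (words (length ρ) n) (c ∷_) _ ⟩
    ∑ (words (length ρ) n) (λ w → if isRearr ρ (c ∷ w) then f (c ∷ w) else 0)
  ≡⟨ ∑-cong (words (length ρ) n) (λ w → cong (λ b → if b then f (c ∷ w) else 0) (isRearr-∷ ρ c w 1≤c c≤m)) ⟩
    ∑ (words (length ρ) n) (λ w → if positive (part ρ c) ∧ isRearr (decrement ρ c) w then f (c ∷ w) else 0)
  ≡⟨ by-first-letter (positive (part ρ c)) refl ⟩
    startingWith ρ f c
  ∎
  where
  open ≡-Reasoning
  by-first-letter : ∀ b → positive (part ρ c) ≡ b →
    ∑ (words (length ρ) n) (λ w → if b ∧ isRearr (decrement ρ c) w then f (c ∷ w) else 0)
      ≡ (if b then ∑ (R (decrement ρ c)) (f ∘ (c ∷_)) else 0)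
  by-first-letter false _   = ∑-zero (words (length ρ) n) (λ _ → refl)
  by-first-letter true  pos = sym (trans (∑-R≡∑-words (decrement ρ c) (f ∘ (c ∷_)))
    (cong₂ (λ m N → ∑ (words m N) (λ w → if isRearr (decrement ρ c) w then f (c ∷ w) else 0))
           (length-decrement ρ c) (suc-injective (trans (sum-decrement ρ c pos) ρ≡1+n))))

∑-R-first-letter : ∀ ρ n → sum ρ ≡ suc n → ∀ f → ∑ (R ρ) f ≡ ∑ (range1 (length ρ)) (startingWith ρ f)
∑-R-first-letter ρ n ρ≡1+n f = begin
    ∑ (R ρ) f
  ≡⟨ ∑-R≡∑-words ρ f ⟩
    ∑ (words (length ρ) (sum ρ)) F
  ≡⟨ cong (λ N → ∑ (words (length ρ) N) F) ρ≡1+n ⟩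
    ∑ (concat (map (λ c → map (c ∷_) (words (length ρ) n)) (range1 (length ρ)))) F
  ≡⟨ ∑-concat (map (λ c → map (c ∷_) (words (length ρ) n)) (range1 (length ρ))) F ⟩
    ∑ (map (λ c → map (c ∷_) (words (length ρ) n)) (range1 (length ρ))) (λ ws → ∑ ws F)
  ≡⟨ ∑-map (range1 (length ρ)) (λ c → map (c ∷_) (words (length ρ) n)) (λ ws → ∑ ws F) ⟩
    ∑ (range1 (length ρ)) (λ c → ∑ (map (c ∷_) (words (length ρ) n)) F)
  ≡⟨ ∑-cong-All (All-range1 (length ρ) (λ c c<m → ∑-words-∷ ρ n ρ≡1+n f (suc c) (s≤s z≤n) c<m)) ⟩
    ∑ (range1 (length ρ)) (startingWith ρ f)
  ∎
  where
  open ≡-Reasoning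
  F : List ℕ → ℕ
  F w = if isRearr ρ w then f w else 0

open Insertion using (insert; onInsertions; insert-[]; ∑-insert-∷)

if-+ : ∀ b x y → (if b then x + y else 0) ≡ (if b then x else 0) + (if b then y else 0)
if-+ true  x y = refl
if-+ false x y = refl

∑-range1-∷ʳ : ∀ ρ k (H : ℕ → ℕ) → ∑ (range1 (length (ρ ∷ʳ k))) H ≡ ∑ (range1 (length ρ)) H + (H (suc (length ρ)) + 0)
∑-range1-∷ʳ ρ k H = trans (cong (λ cs → ∑ cs H) (range1-length-∷ʳ ρ k)) (∑-++ (range1 (length ρ)) _ H)

-- Each rearrangement of ρ ∷ʳ k arises exactly once by inserting k copies of the new largest letter
-- into a rearrangement of ρ; both sides are unfolded along the first letter.
mutual
  ∑-R-∷ʳ : ∀ n ρ → sum ρ ≡ n → ∀ k f → ∑ (R (ρ ∷ʳ k)) f ≡ ∑ (R ρ) (onInsertions (suc (length ρ)) k f)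
  ∑-R-∷ʳ zero ρ ρ≡0 zero f =
    trans (∑-R-empty (ρ ∷ʳ 0) (trans (sum-∷ʳ ρ 0) (trans (+-identityʳ _) ρ≡0)) f)
          (sym (trans (∑-R-empty ρ ρ≡0 _) (+-identityʳ _)))
  ∑-R-∷ʳ zero ρ ρ≡0 (suc k) f = begin
      ∑ (R (ρ ∷ʳ suc k)) f
    ≡⟨ ∑-R-first-letter (ρ ∷ʳ suc k) k (trans (sum-∷ʳ ρ (suc k)) (cong (_+ suc k) ρ≡0)) f ⟩
      ∑ (range1 (length (ρ ∷ʳ suc k))) (startingWith (ρ ∷ʳ suc k) f)
    ≡⟨ ∑-range1-∷ʳ ρ (suc k) _ ⟩
      ∑ (range1 (length ρ)) (startingWith (ρ ∷ʳ suc k) f) + (startingWith (ρ ∷ʳ suc k) f ℓ + 0)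
    ≡⟨ cong₂ (λ p q → p + (q + 0)) (∑-cong-All (All-range1 (length ρ) no-lower-letter)) last-letter ⟩
      ∑ (range1 (length ρ)) (λ _ → 0) + ((onInsertions ℓ (suc k) f [] + 0) + 0)
    ≡⟨ cong (_+ ((onInsertions ℓ (suc k) f [] + 0) + 0)) (∑-zero (range1 (length ρ)) (λ _ → refl)) ⟩
      (onInsertions ℓ (suc k) f [] + 0) + 0
    ≡⟨ cong (_+ 0) (sym (∑-R-empty ρ ρ≡0 (onInsertions ℓ (suc k) f))) ⟩
      ∑ (R ρ) (onInsertions ℓ (suc k) f) + 0
    ≡⟨ +-identityʳ _ ⟩
      ∑ (R ρ) (onInsertions ℓ (suc k) f)
    ∎
    where
    open ≡-Reasoning
    ℓ = suc (length ρ)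
    no-lower-letter : ∀ c → c < length ρ → startingWith (ρ ∷ʳ suc k) f (suc c) ≡ 0
    no-lower-letter c c<m rewrite part-∷ʳ ρ (suc c) (suc k) c<m | sum≡0⇒part≡0 ρ ρ≡0 (suc c) = refl
    last-letter : startingWith (ρ ∷ʳ suc k) f ℓ ≡ onInsertions ℓ (suc k) f [] + 0
    last-letter rewrite part-last ρ (suc k) | decrement-last ρ k =
      trans (∑-R-∷ʳ zero ρ ρ≡0 k (f ∘ (ℓ ∷_)))
            (trans (∑-R-empty ρ ρ≡0 _) (cong (λ ws → ∑ ws (f ∘ (ℓ ∷_)) + 0) (insert-[] ℓ k)))
  ∑-R-∷ʳ (suc n) ρ ρ≡1+n zero f = begin
      ∑ (R (ρ ∷ʳ 0)) f
    ≡⟨ ∑-R-first-letter (ρ ∷ʳ 0) n (trans (sum-∷ʳ ρ 0) (trans (+-identityʳ _) ρ≡1+n)) f ⟩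
      ∑ (range1 (length (ρ ∷ʳ 0))) (startingWith (ρ ∷ʳ 0) f)
    ≡⟨ ∑-range1-∷ʳ ρ 0 _ ⟩
      ∑ (range1 (length ρ)) (startingWith (ρ ∷ʳ 0) f) + (startingWith (ρ ∷ʳ 0) f (suc (length ρ)) + 0)
    ≡⟨ cong₂ (λ p q → p + (q + 0)) (∑-lower-letters n ρ ρ≡1+n 0 f) no-last-letter ⟩
      ∑ (range1 (length ρ)) (startingWith ρ (onInsertions (suc (length ρ)) 0 f)) + 0
    ≡⟨ +-identityʳ _ ⟩
      ∑ (range1 (length ρ)) (startingWith ρ (onInsertions (suc (length ρ)) 0 f))
    ≡⟨ sym (∑-R-first-letter ρ n ρ≡1+n _) ⟩
      ∑ (R ρ) (onInsertions (suc (length ρ)) 0 f)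
    ∎
    where
    open ≡-Reasoning
    no-last-letter : startingWith (ρ ∷ʳ 0) f (suc (length ρ)) ≡ 0
    no-last-letter rewrite part-last ρ 0 = refl
  ∑-R-∷ʳ (suc n) ρ ρ≡1+n (suc k) f = begin
      ∑ (R (ρ ∷ʳ suc k)) f
    ≡⟨ ∑-R-first-letter (ρ ∷ʳ suc k) (n + suc k) (trans (sum-∷ʳ ρ (suc k)) (cong (_+ suc k) ρ≡1+n)) f ⟩
      ∑ (range1 (length (ρ ∷ʳ suc k))) (startingWith (ρ ∷ʳ suc k) f)
    ≡⟨ ∑-range1-∷ʳ ρ (suc k) _ ⟩
      ∑ (range1 m) (startingWith (ρ ∷ʳ suc k) f) + (startingWith (ρ ∷ʳ suc k) f ℓ + 0)
    ≡⟨ cong₂ (λ p q → p + (q + 0)) (∑-lower-letters n ρ ρ≡1+n (suc k) f) last-letter ⟩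
      ∑ (range1 m) lower + (∑ (range1 m) (startingWith ρ (onInsertions ℓ k (f ∘ (ℓ ∷_)))) + 0)
    ≡⟨ cong (∑ (range1 m) lower +_) (+-identityʳ _) ⟩
      ∑ (range1 m) lower + ∑ (range1 m) (startingWith ρ (onInsertions ℓ k (f ∘ (ℓ ∷_))))
    ≡⟨ sym (∑-+ (range1 m) lower _) ⟩
      ∑ (range1 m) (λ c → lower c + startingWith ρ (onInsertions ℓ k (f ∘ (ℓ ∷_))) c)
    ≡⟨ ∑-cong (range1 m) merge ⟩
      ∑ (range1 m) (startingWith ρ (onInsertions ℓ (suc k) f))
    ≡⟨ sym (∑-R-first-letter ρ n ρ≡1+n _) ⟩
      ∑ (R ρ) (onInsertions ℓ (suc k) f)
    ∎
    where
    open ≡-Reasoning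
    m = length ρ
    ℓ = suc m
    lower : ℕ → ℕ
    lower c = if positive (part ρ c) then ∑ (R (decrement ρ c)) (onInsertions ℓ (suc k) (f ∘ (c ∷_))) else 0
    last-letter : startingWith (ρ ∷ʳ suc k) f ℓ ≡ ∑ (range1 m) (startingWith ρ (onInsertions ℓ k (f ∘ (ℓ ∷_))))
    last-letter rewrite part-last ρ (suc k) | decrement-last ρ k =
      trans (∑-R-∷ʳ (suc n) ρ ρ≡1+n k (f ∘ (ℓ ∷_))) (∑-R-first-letter ρ n ρ≡1+n _)
    merge : ∀ c → lower c + startingWith ρ (onInsertions ℓ k (f ∘ (ℓ ∷_))) c ≡ startingWith ρ (onInsertions ℓ (suc k) f) c
    merge c = sym (trans
      (cong (λ z → if positive (part ρ c) then z else 0)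
            (trans (∑-cong (R (decrement ρ c)) (λ u → ∑-insert-∷ ℓ k c u f)) (∑-+ (R (decrement ρ c)) _ _)))
      (if-+ (positive (part ρ c)) _ _))

  ∑-lower-letters : ∀ n ρ → sum ρ ≡ suc n → ∀ k f →
    ∑ (range1 (length ρ)) (startingWith (ρ ∷ʳ k) f)
      ≡ ∑ (range1 (length ρ)) (λ c → if positive (part ρ c)
                                       then ∑ (R (decrement ρ c)) (onInsertions (suc (length ρ)) k (f ∘ (c ∷_))) else 0)
  ∑-lower-letters n ρ ρ≡1+n k f = ∑-cong-All (All-range1 (length ρ) lower-letter)
    where
    lower-letter : ∀ c → c < length ρ → startingWith (ρ ∷ʳ k) f (suc c)
      ≡ (if positive (part ρ (suc c)) then ∑ (R (decrement ρ (suc c))) (onInsertions (suc (length ρ)) k (f ∘ (suc c ∷_))) else 0)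
    lower-letter c c<m rewrite part-∷ʳ ρ (suc c) k c<m | decrement-∷ʳ ρ (suc c) k (s≤s z≤n) c<m =
      by-positivity (positive (part ρ (suc c))) refl
      where
      by-positivity : ∀ b → positive (part ρ (suc c)) ≡ b →
        (if b then ∑ (R (decrement ρ (suc c) ∷ʳ k)) (f ∘ (suc c ∷_)) else 0)
          ≡ (if b then ∑ (R (decrement ρ (suc c))) (onInsertions (suc (length ρ)) k (f ∘ (suc c ∷_))) else 0)
      by-positivity false _   = refl
      by-positivity true  pos =
        trans (∑-R-∷ʳ n (decrement ρ (suc c)) (suc-injective (trans (sum-decrement ρ (suc c) pos) ρ≡1+n)) k (f ∘ (suc c ∷_)))
              (cong (λ L → ∑ (R (decrement ρ (suc c))) (onInsertions (suc L) k (f ∘ (suc c ∷_)))) (length-decrement ρ (suc c)))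

IsWord : ℕ → ℕ → List ℕ → Set
IsWord m n w = length w ≡ n × All (_< suc m) w

words-IsWord : ∀ m n → All (IsWord m n) (words m n)
words-IsWord m zero    = (refl , []) ∷ []
words-IsWord m (suc n) = All.concat⁺ (All.map⁺ (All-range1 m λ c c<m →
  All.map⁺ (All.map (λ {w} (len , letters) → cong suc len , s≤s c<m ∷ letters) (words-IsWord m n))))

R-IsWord : ∀ ρ → All (IsWord (length ρ) (sum ρ)) (R ρ)
R-IsWord ρ = All-filter (isRearr ρ) (words-IsWord (length ρ) (sum ρ))

∑-R-cong : ∀ ρ {f g : List ℕ → ℕ} → (∀ u → IsWord (length ρ) (sum ρ) u → f u ≡ g u) → ∑ (R ρ) f ≡ ∑ (R ρ) g
∑-R-cong ρ eq = ∑-cong-All (All.map (λ {u} → eq u) (R-IsWord ρ))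

module ClosedFormula (X : ℕ → Bool) where

  open DescentRuns X using (weight)

  a : List ℕ → ℕ
  a ρ = sum (map (part ρ) (compl X ρ))

  M : List ℕ → ℕ
  M ρ = multinomial (map (part ρ) (compl X ρ))

  Π : List ℕ → ℕ → ℕ
  Π ρ t = product (map (λ x → binomial (t ∸ a ρ + β X ρ x) (part ρ x)) (inter X ρ))

  compl-bounded : ∀ ρ → All (_≤ length ρ) (compl X ρ)
  compl-bounded ρ = All-filter (not ∘ X) (All-range1 (length ρ) (λ _ c<m → c<m))

  inter-bounded : ∀ ρ → All (_≤ length ρ) (inter X ρ)
  inter-bounded ρ = All-filter X (All-range1 (length ρ) (λ _ c<m → c<m))



  β-∷ʳ : ∀ ρ k x → x ≤ suc (length ρ) → β X (ρ ∷ʳ k) x ≡ β X ρ x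
  β-∷ʳ ρ k x x≤ℓ = cong sum (map-cong-local (All-range1 (x ∸ 1) λ c c<x-1 →
    cong (λ p → if X (suc c) then 0 else p) (part-∷ʳ ρ (suc c) k (≤-trans c<x-1 (∸-monoˡ-≤ 1 x≤ℓ)))))

  β-last : ∀ ρ → β X ρ (suc (length ρ)) ≡ a ρ
  β-last ρ = sym (trans (∑-filter (not ∘ X) (range1 (length ρ)) (part ρ)) (∑-cong (range1 (length ρ)) if-not))
    where
    if-not : ∀ z → (if not (X z) then part ρ z else 0) ≡ (if X z then 0 else part ρ z)
    if-not z with X z
    ... | true  = refl
    ... | false = refl



  module _ (ρ : List ℕ) (k : ℕ) where

    private
      ℓ : ℕ
      ℓ = suc (length ρ)
      ρ′ : List ℕ
      ρ′ = ρ ∷ʳ k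

    Π-terms-∷ʳ : ∀ s → map (λ x → binomial (s + β X ρ′ x) (part ρ′ x)) (inter X ρ)
                     ≡ map (λ x → binomial (s + β X ρ x) (part ρ x)) (inter X ρ)
    Π-terms-∷ʳ s = map-cong-local (All.map (λ {x} x≤m →
      cong₂ (λ b p → binomial (s + b) p) (β-∷ʳ ρ k x (m≤n⇒m≤1+n x≤m)) (part-∷ʳ ρ x k x≤m)) (inter-bounded ρ))

    module _ (ℓ∈X : X ℓ ≡ true) where

      parts-compl-∷ʳ-∈X : map (part ρ′) (compl X ρ′) ≡ map (part ρ) (compl X ρ)
      parts-compl-∷ʳ-∈X rewrite filter-range1-∷ʳ (not ∘ X) ρ k | ℓ∈X | ++-identityʳ (compl X ρ) =
        map-part-∷ʳ ρ k (compl-bounded ρ)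

      a-∷ʳ-∈X : a ρ′ ≡ a ρ
      a-∷ʳ-∈X = cong sum parts-compl-∷ʳ-∈X

      M-∷ʳ-∈X : M ρ′ ≡ M ρ
      M-∷ʳ-∈X = cong multinomial parts-compl-∷ʳ-∈X

      Π-∷ʳ-∈X : ∀ t → Π ρ′ t ≡ Π ρ t * binomial (t ∸ a ρ + a ρ) k
      Π-∷ʳ-∈X t rewrite a-∷ʳ-∈X | filter-range1-∷ʳ X ρ k | ℓ∈X = begin
          product (map F′ (inter X ρ ++ ℓ ∷ []))
        ≡⟨ cong product (map-++ F′ (inter X ρ) (ℓ ∷ [])) ⟩
          product (map F′ (inter X ρ) ++ F′ ℓ ∷ [])
        ≡⟨ product-++ (map F′ (inter X ρ)) (F′ ℓ ∷ []) ⟩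
          product (map F′ (inter X ρ)) * (F′ ℓ * 1)
        ≡⟨ cong₂ (λ p q → product p * q) (Π-terms-∷ʳ (t ∸ a ρ)) (*-identityʳ (F′ ℓ)) ⟩
          Π ρ t * F′ ℓ
        ≡⟨ cong (Π ρ t *_) (cong₂ (λ b p → binomial (t ∸ a ρ + b) p)
                                  (trans (β-∷ʳ ρ k ℓ ≤-refl) (β-last ρ)) (part-last ρ k)) ⟩
          Π ρ t * binomial (t ∸ a ρ + a ρ) k
        ∎
        where
        open ≡-Reasoning
        F′ : ℕ → ℕ
        F′ x = binomial (t ∸ a ρ + β X ρ′ x) (part ρ′ x)

    module _ (ℓ∉X : X ℓ ≡ false) where

      parts-compl-∷ʳ-∉X : map (part ρ′) (compl X ρ′) ≡ map (part ρ) (compl X ρ) ∷ʳ k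
      parts-compl-∷ʳ-∉X rewrite filter-range1-∷ʳ (not ∘ X) ρ k | ℓ∉X
                               | map-++ (part ρ′) (compl X ρ) (ℓ ∷ []) | part-last ρ k =
        cong (_∷ʳ k) (map-part-∷ʳ ρ k (compl-bounded ρ))

      a-∷ʳ-∉X : a ρ′ ≡ a ρ + k
      a-∷ʳ-∉X = trans (cong sum parts-compl-∷ʳ-∉X) (sum-∷ʳ (map (part ρ) (compl X ρ)) k)

      M-∷ʳ-∉X : M ρ′ ≡ binomial (a ρ + k) k * M ρ
      M-∷ʳ-∉X = trans (cong multinomial parts-compl-∷ʳ-∉X) (multinomial-∷ʳ (map (part ρ) (compl X ρ)) k)

      Π-∷ʳ-∉X : ∀ t → Π ρ′ t ≡ Π ρ (t ∸ k)
      Π-∷ʳ-∉X t rewrite a-∷ʳ-∉X | filter-range1-∷ʳ X ρ k | ℓ∉X | ++-identityʳ (inter X ρ)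
                      | +-comm (a ρ) k | sym (∸-+-assoc t k (a ρ)) = cong product (Π-terms-∷ʳ (t ∸ k ∸ a ρ))

  ClosedFormula : List ℕ → Set
  ClosedFormula ρ = ∀ t → ∑ (R ρ) (weight t) ≡ M ρ * binomial t (a ρ) * Π ρ t

  closedFormula-[] : ClosedFormula []
  closedFormula-[] t rewrite binomial-zeroʳ (t + 0) | binomial-zeroʳ t = refl

  closedFormula-∷ʳ-∈X : ∀ ρ k → X (suc (length ρ)) ≡ true → ClosedFormula ρ → ClosedFormula (ρ ∷ʳ k)
  closedFormula-∷ʳ-∈X ρ k ℓ∈X closed t = begin
      ∑ (R (ρ ∷ʳ k)) (weight t)
    ≡⟨ ∑-R-∷ʳ (sum ρ) ρ refl k (weight t) ⟩
      ∑ (R ρ) (onInsertions ℓ k (weight t))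
    ≡⟨ ∑-R-cong ρ (λ u (_ , u<ℓ) → InsertMaximum.∑-insert-weight-∈X X ℓ ℓ∈X t k u u<ℓ) ⟩
      ∑ (R ρ) (λ u → binomial t k * weight t u)
    ≡⟨ ∑-*ˡ (R ρ) (binomial t k) (weight t) ⟩
      binomial t k * ∑ (R ρ) (weight t)
    ≡⟨ cong (binomial t k *_) (closed t) ⟩
      binomial t k * (M ρ * binomial t (a ρ) * Π ρ t)
    ≡⟨ absorb ⟩
      M ρ * binomial t (a ρ) * (Π ρ t * binomial (t ∸ a ρ + a ρ) k)
    ≡⟨ sym (cong₂ (λ m p → m * binomial t p * (Π ρ t * binomial (t ∸ a ρ + a ρ) k))
                  (M-∷ʳ-∈X ρ k ℓ∈X) (a-∷ʳ-∈X ρ k ℓ∈X)) ⟩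
      M (ρ ∷ʳ k) * binomial t (a (ρ ∷ʳ k)) * (Π ρ t * binomial (t ∸ a ρ + a ρ) k)
    ≡⟨ cong (M (ρ ∷ʳ k) * binomial t (a (ρ ∷ʳ k)) *_) (sym (Π-∷ʳ-∈X ρ k ℓ∈X t)) ⟩
      M (ρ ∷ʳ k) * binomial t (a (ρ ∷ʳ k)) * Π (ρ ∷ʳ k) t
    ∎
    where
    open ≡-Reasoning
    ℓ = suc (length ρ)
    absorb : binomial t k * (M ρ * binomial t (a ρ) * Π ρ t) ≡ M ρ * binomial t (a ρ) * (Π ρ t * binomial (t ∸ a ρ + a ρ) k)
    absorb with a ρ ≤? t
    ... | yes a≤t rewrite m∸n+n≡m a≤t = rearrange (binomial t k) (M ρ) (binomial t (a ρ)) (Π ρ t)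
      where
      rearrange : ∀ x y z w → x * (y * z * w) ≡ y * z * (w * x)
      rearrange = solve-∀
    ... | no a≰t rewrite binomial-> (≰⇒> a≰t) | *-zeroʳ (M ρ) = *-zeroʳ (binomial t k)

  closedFormula-∷ʳ-∉X : ∀ ρ k → X (suc (length ρ)) ≡ false → ClosedFormula ρ → ClosedFormula (ρ ∷ʳ k)
  closedFormula-∷ʳ-∉X ρ k ℓ∉X closed t = begin
      ∑ (R (ρ ∷ʳ k)) (weight t)
    ≡⟨ ∑-R-∷ʳ (sum ρ) ρ refl k (weight t) ⟩
      ∑ (R ρ) (onInsertions ℓ k (weight t))
    ≡⟨ ∑-R-cong ρ (λ u (_ , u<ℓ) → InsertMaximum.∑-insert-weight-∉X X ℓ ℓ∉X t k u u<ℓ) ⟩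
      ∑ (R ρ) (λ u → binomial t k * weight (t ∸ k) u)
    ≡⟨ ∑-*ˡ (R ρ) (binomial t k) (weight (t ∸ k)) ⟩
      binomial t k * ∑ (R ρ) (weight (t ∸ k))
    ≡⟨ cong (binomial t k *_) (closed (t ∸ k)) ⟩
      binomial t k * (M ρ * binomial (t ∸ k) (a ρ) * Π ρ (t ∸ k))
    ≡⟨ rearrange (binomial t k) (M ρ) (binomial (t ∸ k) (a ρ)) (Π ρ (t ∸ k)) ⟩
      M ρ * (binomial t k * binomial (t ∸ k) (a ρ)) * Π ρ (t ∸ k)
    ≡⟨ cong (λ z → M ρ * z * Π ρ (t ∸ k)) (binomial-subset-swap t (a ρ) k) ⟩
      M ρ * (binomial (a ρ + k) k * binomial t (a ρ + k)) * Π ρ (t ∸ k)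
    ≡⟨ regroup (M ρ) (binomial (a ρ + k) k) (binomial t (a ρ + k)) (Π ρ (t ∸ k)) ⟩
      binomial (a ρ + k) k * M ρ * binomial t (a ρ + k) * Π ρ (t ∸ k)
    ≡⟨ sym (cong₂ (λ m p → m * binomial t p * Π ρ (t ∸ k)) (M-∷ʳ-∉X ρ k ℓ∉X) (a-∷ʳ-∉X ρ k ℓ∉X)) ⟩
      M (ρ ∷ʳ k) * binomial t (a (ρ ∷ʳ k)) * Π ρ (t ∸ k)
    ≡⟨ cong (M (ρ ∷ʳ k) * binomial t (a (ρ ∷ʳ k)) *_) (sym (Π-∷ʳ-∉X ρ k ℓ∉X t)) ⟩
      M (ρ ∷ʳ k) * binomial t (a (ρ ∷ʳ k)) * Π (ρ ∷ʳ k) t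
    ∎
    where
    open ≡-Reasoning
    ℓ = suc (length ρ)
    rearrange : ∀ x y z w → x * (y * z * w) ≡ y * (x * z) * w
    rearrange = solve-∀
    regroup : ∀ x y z w → x * (y * z) * w ≡ y * x * z * w
    regroup = solve-∀

  closedFormula : ∀ ρ → ClosedFormula ρ
  closedFormula ρ = byLastPart ρ (reverseView ρ)
    where
    byLastPart : ∀ ρ → Reverse ρ → ClosedFormula ρ
    byLastPart .[]       []             = closedFormula-[]
    byLastPart .(ρ ∷ʳ k) (ρ ∶ r ∶ʳ k) with X (suc (length ρ)) in ℓX
    ... | true  = closedFormula-∷ʳ-∈X ρ k ℓX (byLastPart ρ r)
    ... | false = closedFormula-∷ʳ-∉X ρ k ℓX (byLastPart ρ r)

open import Data.Integer using (ℤ; +_; -_)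

∑ℤ : {A : Set} → List A → (A → ℤ) → ℤ
∑ℤ xs f = foldr ℤ._+_ (+ 0) (map f xs)

module _ {A : Set} where

  +-∑ : ∀ (xs : List A) f → + ∑ xs f ≡ ∑ℤ xs (λ x → + f x)
  +-∑ []       f = refl
  +-∑ (x ∷ xs) f = cong (ℤ._+_ (+ f x)) (+-∑ xs f)

  ∑ℤ-cong-All : ∀ {xs : List A} {f g} → All (λ x → f x ≡ g x) xs → ∑ℤ xs f ≡ ∑ℤ xs g
  ∑ℤ-cong-All []         = refl
  ∑ℤ-cong-All (eq ∷ eqs) = cong₂ ℤ._+_ eq (∑ℤ-cong-All eqs)

  ∑ℤ-++ : ∀ (xs ys : List A) f → ∑ℤ (xs ++ ys) f ≡ ∑ℤ xs f ℤ.+ ∑ℤ ys f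
  ∑ℤ-++ []       ys f = sym (ℤ.+-identityˡ _)
  ∑ℤ-++ (x ∷ xs) ys f = trans (cong (ℤ._+_ (f x)) (∑ℤ-++ xs ys f)) (sym (ℤ.+-assoc (f x) _ _))

  ∑ℤ-zero : ∀ (xs : List A) → ∑ℤ xs (λ _ → + 0) ≡ + 0
  ∑ℤ-zero []       = refl
  ∑ℤ-zero (x ∷ xs) = trans (ℤ.+-identityˡ _) (∑ℤ-zero xs)

  ∑ℤ-+ : ∀ (xs : List A) f g → ∑ℤ xs (λ x → f x ℤ.+ g x) ≡ ∑ℤ xs f ℤ.+ ∑ℤ xs g
  ∑ℤ-+ []       f g = refl
  ∑ℤ-+ (x ∷ xs) f g = trans (cong (ℤ._+_ (f x ℤ.+ g x)) (∑ℤ-+ xs f g)) (+-+-comm (f x) (g x) (∑ℤ xs f) (∑ℤ xs g))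
    where
    +-+-comm : ∀ a b c d → a ℤ.+ b ℤ.+ (c ℤ.+ d) ≡ a ℤ.+ c ℤ.+ (b ℤ.+ d)
    +-+-comm = ℤ-Solver.solve-∀

  ∑ℤ-*ˡ : ∀ (xs : List A) c f → ∑ℤ xs (λ x → c ℤ.* f x) ≡ c ℤ.* ∑ℤ xs f
  ∑ℤ-*ˡ []       c f = sym (ℤ.*-zeroʳ c)
  ∑ℤ-*ˡ (x ∷ xs) c f = trans (cong (ℤ._+_ (c ℤ.* f x)) (∑ℤ-*ˡ xs c f)) (sym (ℤ.*-distribˡ-+ c (f x) _))

  ∑ℤ-neg : ∀ (xs : List A) f → ∑ℤ xs (λ x → - f x) ≡ - ∑ℤ xs f
  ∑ℤ-neg []       f = refl
  ∑ℤ-neg (x ∷ xs) f = trans (cong (ℤ._+_ (- f x)) (∑ℤ-neg xs f)) (sym (ℤ.neg-distrib-+ (f x) _))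

∑ℤ-comm : ∀ {A B : Set} (xs : List A) (ys : List B) (F : A → B → ℤ) →
  ∑ℤ xs (λ x → ∑ℤ ys (F x)) ≡ ∑ℤ ys (λ y → ∑ℤ xs (λ x → F x y))
∑ℤ-comm []       ys F = sym (∑ℤ-zero ys)
∑ℤ-comm (x ∷ xs) ys F =
  trans (cong (ℤ._+_ (∑ℤ ys (F x))) (∑ℤ-comm xs ys F)) (sym (∑ℤ-+ ys (F x) (λ y → ∑ℤ xs (λ x′ → F x′ y))))

∑< : ℕ → (ℕ → ℤ) → ℤ
∑< n g = ∑ℤ (upTo n) g

∑<-suc : ∀ n g → ∑< (suc n) g ≡ ∑< n g ℤ.+ g n
∑<-suc n g = trans (cong (λ rs → ∑ℤ rs g) (sym (applyUpTo-∷ʳ id n)))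
                   (trans (∑ℤ-++ (upTo n) (n ∷ []) g) (cong (ℤ._+_ (∑< n g)) (ℤ.+-identityʳ (g n))))

∑<-cong : ∀ n {g h} → (∀ r → r < n → g r ≡ h r) → ∑< n g ≡ ∑< n h
∑<-cong n eq = ∑ℤ-cong-All (All.map (λ {r} → eq r) (All.all-upTo n))

-- Backward difference, with f (-1) read as 0.
Δ : (ℕ → ℤ) → ℕ → ℤ
Δ f zero    = f zero
Δ f (suc N) = f (suc N) ℤ.- f N

Δ-cong : ∀ {f g} → (∀ N → f N ≡ g N) → ∀ N → Δ f N ≡ Δ g N
Δ-cong eq zero    = eq zero
Δ-cong eq (suc N) = cong₂ ℤ._-_ (eq (suc N)) (eq N)

Δ^ : ℕ → (ℕ → ℤ) → ℕ → ℤ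
Δ^ zero    f = f
Δ^ (suc p) f = Δ (Δ^ p f)

Δ^-cong : ∀ p {f g} → (∀ N → f N ≡ g N) → ∀ N → Δ^ p f N ≡ Δ^ p g N
Δ^-cong zero    eq = eq
Δ^-cong (suc p) eq = Δ-cong (Δ^-cong p eq)

alternatingSum : ℕ → (ℕ → ℤ) → ℕ → ℤ
alternatingSum p f N = ∑< (suc N) (λ r → sgn (N ∸ r) ℤ.* + binomial p (N ∸ r) ℤ.* f r)

alternatingSum-zero : ∀ f N → alternatingSum 0 f N ≡ f N
alternatingSum-zero f N = begin
    alternatingSum 0 f N
  ≡⟨ ∑<-suc N _ ⟩
    ∑< N (λ r → sgn (N ∸ r) ℤ.* + binomial 0 (N ∸ r) ℤ.* f r) ℤ.+ sgn (N ∸ N) ℤ.* + binomial 0 (N ∸ N) ℤ.* f N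
  ≡⟨ cong₂ ℤ._+_ (trans (∑<-cong N below-N) (∑ℤ-zero (upTo N))) (cong (λ z → sgn z ℤ.* + binomial 0 z ℤ.* f N) (n∸n≡0 N)) ⟩
    + 0 ℤ.+ (+ 1 ℤ.* + 1 ℤ.* f N)
  ≡⟨ trans (ℤ.+-identityˡ _) (ℤ.*-identityˡ (f N)) ⟩
    f N
  ∎
  where
  open ≡-Reasoning
  below-N : ∀ r → r < N → sgn (N ∸ r) ℤ.* + binomial 0 (N ∸ r) ℤ.* f r ≡ + 0
  below-N r r<N = trans (cong (λ z → sgn z ℤ.* + binomial 0 z ℤ.* f r) (+-∸-assoc 1 r<N))
                        (cong (ℤ._* f r) (ℤ.*-zeroʳ (sgn (suc (N ∸ suc r)))))

alternatingSum-suc : ∀ p f N → alternatingSum (suc p) f N ≡ Δ (alternatingSum p f) N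
alternatingSum-suc p f zero rewrite binomial-zeroʳ p = refl
alternatingSum-suc p f (suc N) = begin
    ∑< (suc (suc N)) term
  ≡⟨ ∑<-suc (suc N) term ⟩
    ∑< (suc N) term ℤ.+ term (suc N)
  ≡⟨ cong₂ ℤ._+_ (trans (∑<-cong (suc N) pascal) (trans (∑ℤ-+ (upTo (suc N)) new (λ r → - old r))
                                                         (cong (ℤ._+_ (∑< (suc N) new)) (∑ℤ-neg (upTo (suc N)) old))))
                 top ⟩
    (∑< (suc N) new ℤ.+ - ∑< (suc N) old) ℤ.+ new (suc N)
  ≡⟨ regroup (∑< (suc N) new) (∑< (suc N) old) (new (suc N)) ⟩
    (∑< (suc N) new ℤ.+ new (suc N)) ℤ.- ∑< (suc N) old
  ≡⟨ cong (ℤ._- ∑< (suc N) old) (sym (∑<-suc (suc N) new)) ⟩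
    Δ (alternatingSum p f) (suc N)
  ∎
  where
  open ≡-Reasoning
  term new old : ℕ → ℤ
  term r = sgn (suc N ∸ r) ℤ.* + binomial (suc p) (suc N ∸ r) ℤ.* f r
  new  r = sgn (suc N ∸ r) ℤ.* + binomial p (suc N ∸ r) ℤ.* f r
  old  r = sgn (N ∸ r) ℤ.* + binomial p (N ∸ r) ℤ.* f r
  regroup : ∀ a c d → (a ℤ.+ - c) ℤ.+ d ≡ (a ℤ.+ d) ℤ.- c
  regroup = ℤ-Solver.solve-∀
  split : ∀ s x y g → (- s) ℤ.* (x ℤ.+ y) ℤ.* g ≡ (- s) ℤ.* y ℤ.* g ℤ.+ - (s ℤ.* x ℤ.* g)
  split = ℤ-Solver.solve-∀
  pascal : ∀ r → r < suc N → term r ≡ new r ℤ.+ - old r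
  pascal r (s≤s r≤N) rewrite +-∸-assoc 1 r≤N = split (sgn (N ∸ r)) (+ binomial p (N ∸ r)) (+ binomial p (suc (N ∸ r))) (f r)
  top : term (suc N) ≡ new (suc N)
  top rewrite n∸n≡0 N | binomial-zeroʳ p = refl

alternatingSum≡Δ^ : ∀ p f N → alternatingSum p f N ≡ Δ^ p f N
alternatingSum≡Δ^ zero    f N = alternatingSum-zero f N
alternatingSum≡Δ^ (suc p) f N = trans (alternatingSum-suc p f N) (Δ-cong (alternatingSum≡Δ^ p f) N)

shiftedBinomial : ℕ → ℕ → ℕ → ℤ
shiftedBinomial u k r = if r <ᵇ u then + 0 else + binomial (r ∸ u + k) k

Δ-shiftedBinomial : ∀ u k N → Δ (shiftedBinomial u (suc k)) N ≡ shiftedBinomial u k N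
Δ-shiftedBinomial zero    k zero = cong +_ (trans (binomial-diag (suc k)) (sym (binomial-diag k)))
Δ-shiftedBinomial (suc u) k zero = refl
Δ-shiftedBinomial u k (suc N) with <-cmp (suc N) u
... | tri< N<u _ _ rewrite <⇒<ᵇ≡true N<u | <⇒<ᵇ≡true (<-trans (n<1+n N) N<u) = refl
... | tri≈ _ refl _ rewrite ≥⇒<ᵇ≡false (≤-refl {suc N}) | <⇒<ᵇ≡true (n<1+n N) | n∸n≡0 N =
  cong +_ (trans (+-identityʳ _) (trans (binomial-diag (suc k)) (sym (binomial-diag k))))
... | tri> _ _ (s≤s u≤N) rewrite ≥⇒<ᵇ≡false (m≤n⇒m≤1+n u≤N) | ≥⇒<ᵇ≡false u≤N | +-∸-assoc 1 u≤N = begin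
    + (binomial (N ∸ u + suc k) k + binomial (N ∸ u + suc k) (suc k)) ℤ.- + binomial (N ∸ u + suc k) (suc k)
  ≡⟨ cancel (+ binomial (N ∸ u + suc k) k) (+ binomial (N ∸ u + suc k) (suc k)) ⟩
    + binomial (N ∸ u + suc k) k
  ≡⟨ cong (λ z → + binomial z k) (+-suc (N ∸ u) k) ⟩
    + binomial (suc (N ∸ u + k)) k
  ∎
  where
  open ≡-Reasoning
  cancel : ∀ x y → (x ℤ.+ y) ℤ.- y ≡ x
  cancel = ℤ-Solver.solve-∀

Δ-shiftedBinomial-zero : ∀ u N → Δ (shiftedBinomial u 0) N ≡ (if N ≡ᵇ u then + 1 else + 0)
Δ-shiftedBinomial-zero zero    zero = refl
Δ-shiftedBinomial-zero (suc u) zero = refl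
Δ-shiftedBinomial-zero u (suc N) with <-cmp (suc N) u
... | tri< N<u _ _ rewrite <⇒<ᵇ≡true N<u | <⇒<ᵇ≡true (<-trans (n<1+n N) N<u) | ≢⇒≡ᵇ≡false (<⇒≢ N<u) = refl
... | tri≈ _ refl _ rewrite ≥⇒<ᵇ≡false (≤-refl {suc N}) | <⇒<ᵇ≡true (n<1+n N) | n∸n≡0 N | ≡ᵇ-refl N = refl
... | tri> _ _ (s≤s u≤N) rewrite ≥⇒<ᵇ≡false (m≤n⇒m≤1+n u≤N) | ≥⇒<ᵇ≡false u≤N | +-∸-assoc 1 u≤N
                               | binomial-zeroʳ (N ∸ u + 0) | ≢⇒≡ᵇ≡false (<⇒≢ (s≤s u≤N) ∘ sym) = refl

Δ^-shiftedBinomial : ∀ j m u N → Δ^ j (shiftedBinomial u (j + m)) N ≡ shiftedBinomial u m N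
Δ^-shiftedBinomial zero    m u N = refl
Δ^-shiftedBinomial (suc j) m u N = trans
  (Δ-cong (λ N′ → trans (cong (λ z → Δ^ j (shiftedBinomial u z) N′) (sym (+-suc j m))) (Δ^-shiftedBinomial j (suc m) u N′)) N)
  (Δ-shiftedBinomial u m N)

-- Extended by zero to negative r, the sequence r ↦ C(r + t, n) has generating function
-- xⁿ⁻ᵗ / (1 − x)ⁿ⁺¹, and Δ multiplies generating functions by 1 − x.
alternatingSum-binomial : ∀ n t N → t ≤ n →
  alternatingSum (suc n) (λ r → + binomial (r + t) n) N ≡ (if N ≡ᵇ n ∸ t then + 1 else + 0)
alternatingSum-binomial n t N t≤n = begin
    alternatingSum (suc n) f N
  ≡⟨ alternatingSum≡Δ^ (suc n) f N ⟩
    Δ (Δ^ n f) N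
  ≡⟨ Δ-cong (Δ^-cong n f≡shifted) N ⟩
    Δ (Δ^ n (shiftedBinomial u (n + 0))) N
  ≡⟨ Δ-cong (Δ^-shiftedBinomial n 0 u) N ⟩
    Δ (shiftedBinomial u 0) N
  ≡⟨ Δ-shiftedBinomial-zero u N ⟩
    (if N ≡ᵇ u then + 1 else + 0)
  ∎
  where
  open ≡-Reasoning
  u = n ∸ t
  f : ℕ → ℤ
  f r = + binomial (r + t) n
  f≡shifted : ∀ r → f r ≡ shiftedBinomial u (n + 0) r
  f≡shifted r rewrite +-identityʳ n with r <? u
  ... | yes r<u rewrite <⇒<ᵇ≡true r<u = cong +_ (binomial-> (subst (r + t <_) (m∸n+n≡m t≤n) (+-monoˡ-< t r<u)))
  ... | no  r≮u rewrite ≥⇒<ᵇ≡false (≮⇒≥ r≮u) = cong (λ z → + binomial z n) (begin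
      r + t              ≡⟨ cong (_+ t) (sym (m∸n+n≡m (≮⇒≥ r≮u))) ⟩
      r ∸ u + u + t      ≡⟨ +-assoc (r ∸ u) u t ⟩
      r ∸ u + (u + t)    ≡⟨ cong (_+_ (r ∸ u)) (m∸n+n≡m t≤n) ⟩
      r ∸ u + n          ∎)

module DescentCount (X : ℕ → Bool) (ρ : List ℕ) (s : ℕ) where

  open DescentRuns X using (weight; desX-≤)
  open ClosedFormula X using (a; M; Π; closedFormula)

  n N : ℕ
  n = sum ρ
  N = n ∸ (a ρ + s)

  hasSDescents : List ℕ → ℕ
  hasSDescents w = if desX X w ≡ᵇ s then 1 else 0

  P≡∑-hasSDescents : P X ρ s ≡ ∑ (R ρ) hasSDescents
  P≡∑-hasSDescents = trans (length≡∑1 (filter (λ w → T? (desX X w ≡ᵇ s)) (R ρ)))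
                           (∑-filter (λ w → desX X w ≡ᵇ s) (R ρ) (λ _ → 1))

  -- At t = a ∸ 1 < a the closed formula vanishes, hence so does every weight (a ∸ 1) w.
  desX+a≤n : All (λ w → length w ≡ n × desX X w + a ρ ≤ n) (R ρ)
  desX+a≤n with a ρ in a≡
  ... | zero  = All.map (λ {w} (len , _) → len , subst (_≤ n) (sym (+-identityʳ _)) (subst (desX X w ≤_) len (desX-≤ w)))
                        (R-IsWord ρ)
  ... | suc a′ = All.map (λ {w} ((len , _) , weight≡0) → len , desX+1+a′≤n w len weight≡0)
                         (All.zip (R-IsWord ρ , ∑≡0⇒All (R ρ) (weight a′) ∑weight≡0))
    where
    ∑weight≡0 : ∑ (R ρ) (weight a′) ≡ 0
    ∑weight≡0 rewrite closedFormula ρ a′ | a≡ | binomial-> (n<1+n a′) | *-zeroʳ (M ρ) = refl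
    desX+1+a′≤n : ∀ w → length w ≡ n → weight a′ w ≡ 0 → desX X w + suc a′ ≤ n
    desX+1+a′≤n w len weight≡0 = subst (_≤ n) (trans (cong suc (+-comm a′ (desX X w))) (sym (+-suc (desX X w) a′)))
                                        (subst (suc (a′ + desX X w) ≤_) len (binomial≡0⇒< _ _ weight≡0))

  hasSDescents≡alternatingSum : a ρ + s ≤ n → ∀ w → desX X w + a ρ ≤ n →
    + hasSDescents w ≡ alternatingSum (suc n) (λ r → + binomial (r + (a ρ + desX X w)) n) N
  hasSDescents≡alternatingSum a+s≤n w d+a≤n = sym (begin
      alternatingSum (suc n) (λ r → + binomial (r + (a ρ + desX X w)) n) N
    ≡⟨ alternatingSum-binomial n (a ρ + desX X w) N a+d≤n ⟩
      (if N ≡ᵇ n ∸ (a ρ + desX X w) then + 1 else + 0)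
    ≡⟨ cong (λ b → if b then + 1 else + 0) same-difference ⟩
      (if desX X w ≡ᵇ s then + 1 else + 0)
    ≡⟨ +-if (desX X w ≡ᵇ s) ⟩
      + hasSDescents w
    ∎)
    where
    open ≡-Reasoning
    a+d≤n : a ρ + desX X w ≤ n
    a+d≤n = subst (_≤ n) (+-comm (desX X w) (a ρ)) d+a≤n
    same-difference : (N ≡ᵇ n ∸ (a ρ + desX X w)) ≡ (desX X w ≡ᵇ s)
    same-difference with desX X w ≟ s
    ... | yes refl rewrite ≡ᵇ-refl N | ≡ᵇ-refl s = refl
    ... | no  d≢s = trans (≢⇒≡ᵇ≡false (d≢s ∘ sym ∘ +-cancelˡ-≡ (a ρ) s (desX X w) ∘ ∸-cancelˡ-≡ a+s≤n a+d≤n))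
                          (sym (≢⇒≡ᵇ≡false d≢s))
    +-if : ∀ b → (if b then + 1 else + 0) ≡ + (if b then 1 else 0)
    +-if true  = refl
    +-if false = refl

  ∑-shifted-weight : ∀ r → ∑ℤ (R ρ) (λ w → + binomial (r + (a ρ + desX X w)) n)
                           ≡ + (M ρ * binomial (r + a ρ) (a ρ) * Π ρ (r + a ρ))
  ∑-shifted-weight r = trans (sym (+-∑ (R ρ) _)) (cong +_ (trans
    (∑-R-cong ρ (λ w (len , _) → cong₂ binomial (sym (+-assoc r (a ρ) (desX X w))) (sym len)))
    (closedFormula ρ (r + a ρ))))

  summand : ℕ → ℤ
  summand r = sgn (N ∸ r) ℤ.* (+ ((a ρ + r) C r)) ℤ.* (+ ((n + 1) C (N ∸ r)))
              ℤ.* (+ product (map (λ x → (r + β X ρ x) C part ρ x) (inter X ρ)))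

  summand≡ : ∀ r → sgn (N ∸ r) ℤ.* + binomial (suc n) (N ∸ r) ℤ.* + (M ρ * binomial (r + a ρ) (a ρ) * Π ρ (r + a ρ))
                 ≡ + M ρ ℤ.* summand r
  summand≡ r = begin
      sgn (N ∸ r) ℤ.* + binomial (suc n) (N ∸ r) ℤ.* + (M ρ * binomial (r + a ρ) (a ρ) * Π ρ (r + a ρ))
    ≡⟨ cong₂ (λ c m → sgn (N ∸ r) ℤ.* + c ℤ.* + m) outer (cong₂ (λ b p → M ρ * b * p) inner factors) ⟩
      sgn (N ∸ r) ℤ.* + ((n + 1) C (N ∸ r)) ℤ.* + (M ρ * ((a ρ + r) C r) * Πᶜ)
    ≡⟨ cong (sgn (N ∸ r) ℤ.* + ((n + 1) C (N ∸ r)) ℤ.*_)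
            (trans (ℤ.pos-* (M ρ * ((a ρ + r) C r)) Πᶜ) (cong (ℤ._* + Πᶜ) (ℤ.pos-* (M ρ) ((a ρ + r) C r)))) ⟩
      sgn (N ∸ r) ℤ.* + ((n + 1) C (N ∸ r)) ℤ.* (+ M ρ ℤ.* + ((a ρ + r) C r) ℤ.* + Πᶜ)
    ≡⟨ rearrange (sgn (N ∸ r)) (+ ((n + 1) C (N ∸ r))) (+ M ρ) (+ ((a ρ + r) C r)) (+ Πᶜ) ⟩
      + M ρ ℤ.* summand r
    ∎
    where
    open ≡-Reasoning
    Πᶜ = product (map (λ x → (r + β X ρ x) C part ρ x) (inter X ρ))
    outer : binomial (suc n) (N ∸ r) ≡ (n + 1) C (N ∸ r)
    outer = trans (binomial≡C (suc n) (N ∸ r)) (cong (_C (N ∸ r)) (+-comm 1 n))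
    inner : binomial (r + a ρ) (a ρ) ≡ (a ρ + r) C r
    inner = trans (sym (binomial-sym r (a ρ))) (trans (cong (λ z → binomial z r) (+-comm r (a ρ))) (binomial≡C (a ρ + r) r))
    factors : Π ρ (r + a ρ) ≡ Πᶜ
    factors = cong product (map-cong (λ x → trans (cong (λ z → binomial (z + β X ρ x) (part ρ x)) (m+n∸n≡m r (a ρ)))
                                                  (binomial≡C (r + β X ρ x) (part ρ x))) (inter X ρ))
    rearrange : ∀ σ c m b p → σ ℤ.* c ℤ.* (m ℤ.* b ℤ.* p) ≡ m ℤ.* (σ ℤ.* b ℤ.* c ℤ.* p)
    rearrange = ℤ-Solver.solve-∀

  ∑-hasSDescents-large : n < a ρ + s → ∑ (R ρ) hasSDescents ≡ 0
  ∑-hasSDescents-large n<a+s = trans (∑-cong-All (All.map (λ {w} (_ , d+a≤n) → none w d+a≤n) desX+a≤n))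
                                    (∑-zero (R ρ) (λ _ → refl))
    where
    none : ∀ w → desX X w + a ρ ≤ n → hasSDescents w ≡ 0
    none w d+a≤n = cong (λ b → if b then 1 else 0) (≢⇒≡ᵇ≡false λ d≡s →
      <⇒≱ n<a+s (subst (_≤ n) (trans (+-comm (desX X w) (a ρ)) (cong (_+_ (a ρ)) d≡s)) d+a≤n))

  +∑-hasSDescents : a ρ + s ≤ n → + ∑ (R ρ) hasSDescents ≡ + M ρ ℤ.* Σ≤ N summand
  +∑-hasSDescents a+s≤n = begin
      + ∑ (R ρ) hasSDescents
    ≡⟨ +-∑ (R ρ) hasSDescents ⟩
      ∑ℤ (R ρ) (λ w → + hasSDescents w)
    ≡⟨ ∑ℤ-cong-All (All.map (λ {w} (_ , d+a≤n) → hasSDescents≡alternatingSum a+s≤n w d+a≤n) desX+a≤n) ⟩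
      ∑ℤ (R ρ) (λ w → ∑< (suc N) (λ r → coefficient r ℤ.* + binomial (r + (a ρ + desX X w)) n))
    ≡⟨ ∑ℤ-comm (R ρ) (upTo (suc N)) _ ⟩
      ∑< (suc N) (λ r → ∑ℤ (R ρ) (λ w → coefficient r ℤ.* + binomial (r + (a ρ + desX X w)) n))
    ≡⟨ ∑<-cong (suc N) (λ r _ → trans (∑ℤ-*ˡ (R ρ) (coefficient r) _) (cong (coefficient r ℤ.*_) (∑-shifted-weight r))) ⟩
      ∑< (suc N) (λ r → coefficient r ℤ.* + (M ρ * binomial (r + a ρ) (a ρ) * Π ρ (r + a ρ)))
    ≡⟨ ∑<-cong (suc N) (λ r _ → summand≡ r) ⟩
      ∑< (suc N) (λ r → + M ρ ℤ.* summand r)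
    ≡⟨ ∑ℤ-*ˡ (upTo (suc N)) (+ M ρ) summand ⟩
      + M ρ ℤ.* Σ≤ N summand
    ∎
    where
    open ≡-Reasoning
    coefficient : ℕ → ℤ
    coefficient r = sgn (N ∸ r) ℤ.* + binomial (suc n) (N ∸ r)

  +P≡RHS : + P X ρ s ≡ RHS X ρ n s
  +P≡RHS = trans (cong +_ P≡∑-hasSDescents) (by-size (n <ᵇ (a ρ + s)) refl)
    where
    by-size : ∀ b → (n <ᵇ (a ρ + s)) ≡ b → + ∑ (R ρ) hasSDescents ≡ (if b then + 0 else + M ρ ℤ.* Σ≤ N summand)
    by-size true  n<a+s = cong +_ (∑-hasSDescents-large (<ᵇ⇒< n (a ρ + s) (subst T (sym n<a+s) _)))
    by-size false n≮a+s = +∑-hasSDescents (≮⇒≥ (λ n<a+s → subst T n≮a+s (<⇒<ᵇ n<a+s)))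

corollary5p7 : (X : ℕ → Bool) (n : ℕ) (ρ : List ℕ) → AllPos ρ → sum ρ ≡ n →
    (s : ℕ) → + P X ρ s ≡ RHS X ρ n s
corollary5p7 X .(sum ρ) ρ _ refl s = DescentCount.+P≡RHS X ρ s
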